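{- Let $p(n,k)$ denote the number of partitions of the integer $n$ into exactly $k$ positive parts (unordered), and $q(n,k)$ the number of partitions of $n$ into exactly $k$ pairwise distinct positive parts. Let $(n_m,k_m)_{m\ge1}$ be a sequence of pairs of integers with $n_m\ge k_m\ge 1$ and $n_m\to\infty$. Then: (i) if $n_m/k_m^3\to\infty$, then $q(n_m,k_m)/p(n_m,k_m)\to 1$; (ii) if $n_m/k_m^3\to 0$, then $q(n_m,k_m)/p(n_m,k_m)\to 0$. That is, for a uniformly random partition of $n$ into $k$ positive parts, the probability that all parts are distinct tends to $1$ when $n/k^3\to\infty$ and to $0$ when $n/k^3\to 0$. -}

module Defs where

open import Data.Bool using (Bool; true; false; _∧_)
open import Data.Nat using (ℕ; zero; suc; _≤ᵇ_; _<ᵇ_; _≡ᵇ_; _≤_; _<_; _*_; _^_)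
open import Data.List using (List; []; _∷_; map; concatMap; upTo; length; filterᵇ)
open import Data.Vec using (Vec; []; _∷_) renaming (sum to vsum)
open import Data.Integer using (+_)
open import Data.Rational using (ℚ; 0ℚ; _/_)

allVecs : (k b : ℕ) → List (Vec ℕ k)
allVecs zero    b = [] ∷ []
allVecs (suc k) b = concatMap (λ x → map (x ∷_) (allVecs k b)) (upTo (suc b))

allPos : ∀ {k} → Vec ℕ k → Bool
allPos []       = true
allPos (x ∷ xs) = (1 ≤ᵇ x) ∧ allPos xs

-- weakly decreasing (canonical representative of an unordered multiset of parts)
nonIncr : ∀ {k} → Vec ℕ k → Bool
nonIncr []           = true
nonIncr (x ∷ [])     = true
nonIncr (x ∷ y ∷ xs) = (y ≤ᵇ x) ∧ nonIncr (y ∷ xs)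

strictDecr : ∀ {k} → Vec ℕ k → Bool
strictDecr []           = true
strictDecr (x ∷ [])     = true
strictDecr (x ∷ y ∷ xs) = (y <ᵇ x) ∧ strictDecr (y ∷ xs)

isPartition : (n k : ℕ) → Vec ℕ k → Bool
isPartition n k v = allPos v ∧ nonIncr v ∧ (vsum v ≡ᵇ n)

isDistinctPartition : (n k : ℕ) → Vec ℕ k → Bool
isDistinctPartition n k v = allPos v ∧ strictDecr v ∧ (vsum v ≡ᵇ n)

-- p(n,k): number of partitions of n into exactly k positive parts
-- (each part is ≤ n, so enumerating entries in {0..n} is exhaustive)
p : ℕ → ℕ → ℕ
p n k = length (filterᵇ (isPartition n k) (allVecs k n))

q : ℕ → ℕ → ℕ
q n k = length (filterᵇ (isDistinctPartition n k) (allVecs k n))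

-- the rational a / b (set to 0 when b = 0; under the theorem's hypotheses b = p(n,k) > 0)
frac : ℕ → ℕ → ℚ
frac a zero    = 0ℚ
frac a (suc b) = (+ a) / suc b

invSuc : ℕ → ℚ
invSuc j = (+ 1) / suc j

module Submission where

-- Write P k s for the number of partitions of s into k positive parts.
--  * Chain counts: counting non-increasing, resp. strictly decreasing, vectors inside the
--    enumerations of Defs by their first entry gives recursive counts, so p n k = P k n; and
--    subtracting the staircase (k-1, …, 1, 0) gives q n k = P k (n - Δ k), Δ k = k(k-1)/2.
--  * The recursion P (k+1) (s+1) = P k s + P (k+1) (s-k) (some part is 1, or lower every
--    part by 1) makes P (k+1) monotone, so q ≤ p.
--  * Part (i).  Peeling the recursion k times gives p - q ≤ k · P (k-1) (n-1).  Rising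
--    factorials sandwich P:  (m+1)⋯(m+r) ≤ (r+1)! r! · P (r+1) (m+r+1) ≤ (m+Δ+1)⋯(m+Δ+r),
--    whence P (k-1) (n-1) ≤ (2k²/n) · P k n roughly, and (j+1)(p - q) ≤ p once n ≥ (2j+3) k³.
--  * Part (ii).  Merging a distinct partition v at a site i (lower v_i to v_{i+1}, add the gap
--    v_i - v_{i+1} to the largest part) is injective on pairs (v, i).  When n ≪ k³ most sites
--    k/2 < i < k have a gap ≤ B for a suitable B, so double counting the pairs gives
--    q · (number of small sites) ≤ p · B, and hence (j+1) q ≤ p once 512 (j+1)² n < k³.
--  * Both integer inequalities are finally read as the rational statements about q/p.

open import Data.Bool using (Bool; true; false; _∧_; not; if_then_else_; T)
open import Data.Bool.Properties using (∧-zeroʳ; ∧-identityʳ; T?)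
open import Data.Bool.Solver using (module ∨-∧-Solver)
open import Data.Empty using (⊥-elim)
open import Data.Unit using (tt)
open import Data.Nat hiding (∣_-_∣)
open import Data.Nat.Properties
open import Data.Nat.Induction using (<-rec)
open import Data.Nat.DivMod using (m/n*n≤m; m%n<n; m≡m%n+[m/n]*n)
open import Data.Nat.Tactic.RingSolver using (solve-∀)
open import Data.List using (List; []; _∷_; map; concatMap; upTo; applyUpTo; length; filterᵇ; _++_; cartesianProduct)
open import Data.Vec using (Vec; []; _∷_; head) renaming (sum to vsum)
open import Data.Product using (Σ; _×_; _,_; proj₁; proj₂)
open import Function using (_∘_; id)
open import Relation.Binary.PropositionalEquality
open import Relation.Nullary using (yes; no)
open import Relation.Binary.Definitions using (Tri; tri<; tri≈; tri>)
open import Data.List.Membership.Propositional using (_∈_)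
open import Data.List.Membership.Propositional.Properties
  using (∈-map⁺; ∈-map⁻; ∈-concat⁺′; ∈-concat⁻′; ∈-upTo⁺; ∈-upTo⁻; ∈-filter⁺; ∈-filter⁻; ∈-cartesianProduct⁺; ∈-cartesianProduct⁻)
open import Data.List.Relation.Unary.Any using (here; there)
import Data.List.Relation.Unary.All as All
open All using ([]; _∷_)
open import Data.List.Relation.Unary.AllPairs using ([]; _∷_)
open import Data.List.Relation.Unary.Unique.Propositional using (Unique)
import Data.List.Relation.Unary.Unique.Propositional.Properties as Unique
open import Data.Rational using (ℚ; _-_; ∣_∣; 1ℚ) renaming (_≤_ to _≤ℚ_)
open import Defs

T⇒≡true : ∀ {b} → T b → b ≡ true
T⇒≡true {true} _ = refl

≡true⇒T : ∀ {b} → b ≡ true → T b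
≡true⇒T refl = tt

≤ᵇ-sound : ∀ {m n} → (m ≤ᵇ n) ≡ true → m ≤ n
≤ᵇ-sound {m} {n} e = ≤ᵇ⇒≤ m n (≡true⇒T e)

≤ᵇ-true : ∀ {m n} → m ≤ n → (m ≤ᵇ n) ≡ true
≤ᵇ-true le = T⇒≡true (≤⇒≤ᵇ le)

≤ᵇ-false : ∀ {m n} → n < m → (m ≤ᵇ n) ≡ false
≤ᵇ-false {m} {n} lt with m ≤ᵇ n in e
... | false = refl
... | true  = ⊥-elim (<⇒≱ lt (≤ᵇ-sound e))

≤ᵇ-false⇒> : ∀ {m n} → (m ≤ᵇ n) ≡ false → n < m
≤ᵇ-false⇒> e = ≰⇒> (λ le → subst T e (≤⇒≤ᵇ le))

≡ᵇ-sound : ∀ {m n} → (m ≡ᵇ n) ≡ true → m ≡ n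
≡ᵇ-sound {m} {n} e = ≡ᵇ⇒≡ m n (≡true⇒T e)

≡ᵇ-true : ∀ {m n} → m ≡ n → (m ≡ᵇ n) ≡ true
≡ᵇ-true {m} {n} e = T⇒≡true (≡⇒≡ᵇ m n e)

∧-true⁻ : ∀ {a b} → a ∧ b ≡ true → (a ≡ true) × (b ≡ true)
∧-true⁻ {true} {true} _ = refl , refl

∧-true⁺ : ∀ {a b} → a ≡ true → b ≡ true → a ∧ b ≡ true
∧-true⁺ refl refl = refl

Sum : ℕ → (ℕ → ℕ) → ℕ
Sum zero    f = 0
Sum (suc n) f = Sum n f + f n

Sum-shift : ∀ n f → Sum (suc n) f ≡ f 0 + Sum n (f ∘ suc)
Sum-shift zero    f = +-comm 0 (f 0)
Sum-shift (suc n) f = trans (cong (_+ f (suc n)) (Sum-shift n f)) (+-assoc (f 0) _ _)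

Sum-cong : ∀ n f g → (∀ x → x < n → f x ≡ g x) → Sum n f ≡ Sum n g
Sum-cong zero    f g e = refl
Sum-cong (suc n) f g e = cong₂ _+_ (Sum-cong n f g (λ x x<n → e x (m<n⇒m<1+n x<n))) (e n ≤-refl)

Sum-mono : ∀ n f g → (∀ x → x < n → f x ≤ g x) → Sum n f ≤ Sum n g
Sum-mono zero    f g h = z≤n
Sum-mono (suc n) f g h = +-mono-≤ (Sum-mono n f g (λ x lt → h x (m<n⇒m<1+n lt))) (h n ≤-refl)

Sum-zero : ∀ n f → (∀ x → x < n → f x ≡ 0) → Sum n f ≡ 0
Sum-zero zero    f e = refl
Sum-zero (suc n) f e = cong₂ _+_ (Sum-zero n f (λ x lt → e x (m<n⇒m<1+n lt))) (e n ≤-refl)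

Sum-+ : ∀ n f g → Sum n (λ x → f x + g x) ≡ Sum n f + Sum n g
Sum-+ zero    f g = refl
Sum-+ (suc n) f g = trans (cong (_+ (f n + g n)) (Sum-+ n f g)) (swap (Sum n f) (Sum n g) (f n) (g n))
  where
  swap : ∀ a b c d → a + b + (c + d) ≡ a + c + (b + d)
  swap = solve-∀

Sum-*ˡ : ∀ c n f → c * Sum n f ≡ Sum n (λ x → c * f x)
Sum-*ˡ c zero    f = *-zeroʳ c
Sum-*ˡ c (suc n) f = trans (*-distribˡ-+ c (Sum n f) (f n)) (cong (_+ c * f n) (Sum-*ˡ c n f))

Sum-split : ∀ a b f → Sum (a + b) f ≡ Sum a f + Sum b (λ y → f (a + y))
Sum-split a zero    f = trans (cong (λ z → Sum z f) (+-identityʳ a)) (sym (+-identityʳ _))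
Sum-split a (suc b) f = trans (cong (λ z → Sum z f) (+-suc a b))
                              (trans (cong (_+ f (a + b)) (Sum-split a b f)) (+-assoc (Sum a f) _ _))

Sum-truncate : ∀ m n f → m ≤ n → (∀ x → m ≤ x → f x ≡ 0) → Sum n f ≡ Sum m f
Sum-truncate m n f m≤n vanish = begin
    Sum n f                                   ≡⟨ cong (λ z → Sum z f) (sym (m+[n∸m]≡n m≤n)) ⟩
    Sum (m + (n ∸ m)) f                       ≡⟨ Sum-split m (n ∸ m) f ⟩
    Sum m f + Sum (n ∸ m) (λ y → f (m + y))   ≡⟨ cong (Sum m f +_) (Sum-zero (n ∸ m) _ (λ y _ → vanish (m + y) (m≤m+n m y))) ⟩
    Sum m f + 0                               ≡⟨ +-identityʳ _ ⟩
    Sum m f                                   ∎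
  where open ≡-Reasoning

Sum-const : ∀ n c → Sum n (λ _ → c) ≡ n * c
Sum-const zero    c = refl
Sum-const (suc n) c = trans (cong (_+ c) (Sum-const n c)) (+-comm (n * c) c)

Sum-≥ : ∀ m f c → (∀ x → x < m → c ≤ f x) → m * c ≤ Sum m f
Sum-≥ m f c h = subst (_≤ Sum m f) (Sum-const m c) (Sum-mono m (λ _ → c) f h)

Sum-telescope : ∀ (W : ℕ → ℕ) L → (∀ t → t < L → W (suc t) ≤ W t) → Sum L (λ t → W t ∸ W (suc t)) + W L ≡ W 0
Sum-telescope W zero    h = refl
Sum-telescope W (suc L) h =
  trans (+-assoc (Sum L _) _ (W (suc L)))
        (trans (cong (Sum L (λ t → W t ∸ W (suc t)) +_) (m∸n+n≡m (h L ≤-refl)))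
               (Sum-telescope W L (λ t lt → h t (m<n⇒m<1+n lt))))

ι : Bool → ℕ
ι b = if b then 1 else 0

count : {A : Set} → (A → Bool) → List A → ℕ
count P []       = 0
count P (x ∷ xs) = ι (P x) + count P xs

length-filterᵇ : ∀ {A : Set} (P : A → Bool) xs → length (filterᵇ P xs) ≡ count P xs
length-filterᵇ P []       = refl
length-filterᵇ P (x ∷ xs) with P x
... | true  = cong suc (length-filterᵇ P xs)
... | false = length-filterᵇ P xs

count-++ : ∀ {A : Set} (P : A → Bool) xs ys → count P (xs ++ ys) ≡ count P xs + count P ys
count-++ P []       ys = refl
count-++ P (x ∷ xs) ys = trans (cong (ι (P x) +_) (count-++ P xs ys)) (sym (+-assoc (ι (P x)) _ _))

count-map : ∀ {A B : Set} (P : B → Bool) (f : A → B) xs → count P (map f xs) ≡ count (P ∘ f) xs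
count-map P f []       = refl
count-map P f (x ∷ xs) = cong (ι (P (f x)) +_) (count-map P f xs)

count-cong : ∀ {A : Set} (P Q : A → Bool) → (∀ x → P x ≡ Q x) → ∀ xs → count P xs ≡ count Q xs
count-cong P Q e []       = refl
count-cong P Q e (x ∷ xs) = cong₂ _+_ (cong ι (e x)) (count-cong P Q e xs)

count-none : ∀ {A : Set} (P : A → Bool) → (∀ x → P x ≡ false) → ∀ xs → count P xs ≡ 0
count-none P none []       = refl
count-none P none (x ∷ xs) = trans (cong (λ b → ι b + count P xs) (none x)) (count-none P none xs)

count-applyUpTo : ∀ {A : Set} (P : A → Bool) (f : ℕ → A) n → count P (applyUpTo f n) ≡ Sum n (λ x → ι (P (f x)))
count-applyUpTo P f zero    = refl
count-applyUpTo P f (suc n) =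
  trans (cong (ι (P (f 0)) +_) (count-applyUpTo P (f ∘ suc) n)) (sym (Sum-shift n (λ x → ι (P (f x)))))

count-concatMap : ∀ {A : Set} (P : A → Bool) (h : ℕ → List A) (f : ℕ → ℕ) n →
                  count P (concatMap h (applyUpTo f n)) ≡ Sum n (λ x → count P (h (f x)))
count-concatMap P h f zero    = refl
count-concatMap P h f (suc n) =
  trans (count-++ P (h (f 0)) _)
        (trans (cong (count P (h (f 0)) +_) (count-concatMap P h (f ∘ suc) n)) (sym (Sum-shift n _)))

count-product : ∀ {A B : Set} (P : A → Bool) (Q : B → Bool) xs ys →
  count (λ z → P (proj₁ z) ∧ Q (proj₂ z)) (cartesianProduct xs ys) ≡ count P xs * count Q ys
count-product P Q []       ys = refl
count-product P Q (x ∷ xs) ys =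
  trans (count-++ _ (map (x ,_) ys) (cartesianProduct xs ys))
        (trans (cong₂ _+_ (count-map _ (x ,_) ys) (count-product P Q xs ys)) (row (P x)))
  where
  row : ∀ b → count (λ y → b ∧ Q y) ys + count P xs * count Q ys ≡ (ι b + count P xs) * count Q ys
  row true  = refl
  row false = cong (_+ count P xs * count Q ys) (count-none _ (λ _ → refl) ys)

count-product-≥ : ∀ {A B : Set} (P : A → Bool) (Q : A → B → Bool) G xs ys →
  (∀ x → P x ≡ true → G ≤ count (Q x) ys) →
  count P xs * G ≤ count (λ z → P (proj₁ z) ∧ Q (proj₁ z) (proj₂ z)) (cartesianProduct xs ys)
count-product-≥ P Q G []       ys h = z≤n
count-product-≥ P Q G (x ∷ xs) ys h =
  subst (_ ≤_) (sym (trans (count-++ _ (map (x ,_) ys) (cartesianProduct xs ys)) (cong (_+ _) (count-map _ (x ,_) ys))))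
        (row (P x) refl)
  where
  tail : ℕ
  tail = count (λ z → P (proj₁ z) ∧ Q (proj₁ z) (proj₂ z)) (cartesianProduct xs ys)
  rest : count P xs * G ≤ tail
  rest = count-product-≥ P Q G xs ys h
  row : ∀ b → P x ≡ b → (ι b + count P xs) * G ≤ count (λ y → b ∧ Q x y) ys + tail
  row true  e = +-mono-≤ (h x e) rest
  row false e = ≤-trans rest (≤-reflexive (sym (cong (_+ tail) (count-none _ (λ _ → refl) ys))))

-- With f = id these are partitions written in non-increasing
-- order, with f = pred partitions into distinct parts; chainCount counts chains by length
-- and sum through the choice of the first entry x (the summand `branch`).

isChain : ∀ {k} → (ℕ → ℕ) → ℕ → Vec ℕ k → Bool
isChain f c []      = true
isChain f c (x ∷ v) = (1 ≤ᵇ x) ∧ ((x ≤ᵇ c) ∧ isChain f (f x) v)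

chainCount : (ℕ → ℕ) → (k s c : ℕ) → ℕ
branch : (ℕ → ℕ) → (k s x : ℕ) → ℕ

chainCount f zero    zero    c = 1
chainCount f zero    (suc s) c = 0
chainCount f (suc k) s       c = Sum (suc c) (branch f k s)

branch f k s x = if (1 ≤ᵇ x) ∧ (x ≤ᵇ s) then chainCount f k (s ∸ x) (f x) else 0

-- P≤ k s c: partitions of s into k parts, each at most c.  P k s: all partitions of s into k parts.
P≤ : ℕ → ℕ → ℕ → ℕ
P≤ = chainCount id

P : ℕ → ℕ → ℕ
P k s = P≤ k s s

≡ᵇ-cancel : ∀ x s t → x ≤ s → (x + t ≡ᵇ s) ≡ (t ≡ᵇ s ∸ x)
≡ᵇ-cancel zero    s       t _         = refl
≡ᵇ-cancel (suc x) (suc s) t (s≤s le) = ≡ᵇ-cancel x s t le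

≡ᵇ-too-big : ∀ x s t → s < x → (x + t ≡ᵇ s) ≡ false
≡ᵇ-too-big (suc x) zero    t _         = refl
≡ᵇ-too-big (suc x) (suc s) t (s≤s lt) = ≡ᵇ-too-big x s t lt

-- Counting the chains inside the enumeration allVecs k b (entries ≤ b) gives chainCount,
-- provided f never increases (so all entries stay ≤ c ≤ b).
count-chains : ∀ b f → (∀ x → f x ≤ x) → ∀ k s c → c ≤ b →
  count (λ v → isChain f c v ∧ (vsum v ≡ᵇ s)) (allVecs k b) ≡ chainCount f k s c
count-chains b f f≤id zero    zero    c _   = refl
count-chains b f f≤id zero    (suc s) c _   = refl
count-chains b f f≤id (suc k) s       c c≤b = begin
    count test (concatMap (λ x → map (x ∷_) L) (upTo (suc b)))
  ≡⟨ count-concatMap test (λ x → map (x ∷_) L) id (suc b) ⟩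
    Sum (suc b) (λ x → count test (map (x ∷_) L))
  ≡⟨ Sum-cong (suc b) _ capped (λ x _ → trans (count-map test (x ∷_) L) (first-entry x)) ⟩
    Sum (suc b) capped
  ≡⟨ Sum-truncate (suc c) (suc b) capped (s≤s c≤b) (λ x c<x → cong (λ t → if t then _ else 0) (≤ᵇ-false c<x)) ⟩
    Sum (suc c) capped
  ≡⟨ Sum-cong (suc c) capped (branch f k s) (λ x x≤c → cong (λ t → if t then _ else 0) (≤ᵇ-true (≤-pred x≤c))) ⟩
    chainCount f (suc k) s c ∎
  where
  open ≡-Reasoning
  L : List (Vec ℕ k)
  L = allVecs k b
  test : Vec ℕ (suc k) → Bool
  test v = isChain f c v ∧ (vsum v ≡ᵇ s)
  capped : ℕ → ℕ
  capped x = if x ≤ᵇ c then branch f k s x else 0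
  -- chains with first entry x are chains of length k below f x with sum s - x
  first-entry : ∀ x → count (test ∘ (x ∷_)) L ≡ capped x
  first-entry zero = count-none _ (λ _ → refl) L
  first-entry (suc x) with suc x ≤ᵇ c in x≤c
  ... | false = count-none _ (λ _ → refl) L
  ... | true with suc x ≤ᵇ s in x≤s
  ...   | true  = trans (count-cong _ _ (λ v → cong (isChain f (f (suc x)) v ∧_) (≡ᵇ-cancel (suc x) s (vsum v) (≤ᵇ-sound x≤s))) L)
                        (count-chains b f f≤id k (s ∸ suc x) (f (suc x)) (≤-trans (f≤id (suc x)) (≤-trans (≤ᵇ-sound x≤c) c≤b)))
  ...   | false = count-none _ (λ v → trans (cong (isChain f (f (suc x)) v ∧_) (≡ᵇ-too-big (suc x) s (vsum v) (≤ᵇ-false⇒> x≤s)))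
                                               (∧-zeroʳ _)) L

headLe : ∀ {k} → ℕ → Vec ℕ k → Bool
headLe c []      = true
headLe c (x ∷ v) = x ≤ᵇ c

headLe-sum : ∀ {k} n (v : Vec ℕ k) → vsum v ≡ n → headLe n v ≡ true
headLe-sum n []      e = refl
headLe-sum n (x ∷ v) e = ≤ᵇ-true (subst (x ≤_) e (m≤m+n x (vsum v)))

≤ᵇ-as-<ᵇ : ∀ y x → (y ≤ᵇ x) ≡ (y <ᵇ suc x)
≤ᵇ-as-<ᵇ zero    x = refl
≤ᵇ-as-<ᵇ (suc y) x = refl

module _ where
  open ∨-∧-Solver

  isChain-id : ∀ {k} c (v : Vec ℕ k) → isChain id c v ≡ allPos v ∧ (nonIncr v ∧ headLe c v)
  isChain-id c []          = refl
  isChain-id c (x ∷ [])    =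
    solve 2 (λ a b → a :* (b :* con true) := (a :* con true) :* (con true :* b)) refl (1 ≤ᵇ x) (x ≤ᵇ c)
  isChain-id c (x ∷ y ∷ v) rewrite isChain-id x (y ∷ v) =
    solve 5 (λ a b c d e → a :* (b :* (c :* (d :* e))) := (a :* c) :* ((e :* d) :* b)) refl
      (1 ≤ᵇ x) (x ≤ᵇ c) (allPos (y ∷ v)) (nonIncr (y ∷ v)) (y ≤ᵇ x)

  isChain-pred : ∀ {k} c (v : Vec ℕ k) → isChain pred c v ≡ allPos v ∧ (strictDecr v ∧ headLe c v)
  isChain-pred c []                = refl
  isChain-pred c (x ∷ [])          =
    solve 2 (λ a b → a :* (b :* con true) := (a :* con true) :* (con true :* b)) refl (1 ≤ᵇ x) (x ≤ᵇ c)
  isChain-pred c (zero ∷ y ∷ v)    = refl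
  isChain-pred c (suc x ∷ y ∷ v) rewrite isChain-pred x (y ∷ v) | ≤ᵇ-as-<ᵇ y x =
    solve 5 (λ a b c d e → a :* (b :* (c :* (d :* e))) := (a :* c) :* ((e :* d) :* b)) refl
      (1 ≤ᵇ suc x) (suc x ≤ᵇ c) (allPos (y ∷ v)) (strictDecr (y ∷ v)) (y <ᵇ suc x)

-- once the sum is n, "first entry ≤ n" is automatic
add-headLe : ∀ {k} n (v : Vec ℕ k) a b → a ∧ (b ∧ (vsum v ≡ᵇ n)) ≡ (a ∧ (b ∧ headLe n v)) ∧ (vsum v ≡ᵇ n)
add-headLe n v a b with vsum v ≡ᵇ n in e
... | false = trans (cong (a ∧_) (∧-zeroʳ b)) (trans (∧-zeroʳ a) (sym (∧-zeroʳ _)))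
... | true  rewrite headLe-sum n v (≡ᵇ-sound e) = sym (∧-identityʳ _)

p≡P : ∀ n k → p n k ≡ P k n
p≡P n k =
  trans (length-filterᵇ _ (allVecs k n))
        (trans (count-cong _ _ char (allVecs k n)) (count-chains n id (λ x → ≤-refl) k n n ≤-refl))
  where
  char : ∀ v → isPartition n k v ≡ isChain id n v ∧ (vsum v ≡ᵇ n)
  char v rewrite isChain-id n v = add-headLe n v (allPos v) (nonIncr v)

q≡chainCount : ∀ n k → q n k ≡ chainCount pred k n n
q≡chainCount n k =
  trans (length-filterᵇ _ (allVecs k n))
        (trans (count-cong _ _ char (allVecs k n)) (count-chains n pred (λ x → pred[n]≤n {x}) k n n ≤-refl))
  where
  char : ∀ v → isDistinctPartition n k v ≡ isChain pred n v ∧ (vsum v ≡ᵇ n)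
  char v rewrite isChain-pred n v = add-headLe n v (allPos v) (strictDecr v)

branch-beyond : ∀ f k s x → s < x → branch f k s x ≡ 0
branch-beyond f k s x s<x =
  trans (cong (λ b → if (1 ≤ᵇ x) ∧ b then chainCount f k (s ∸ x) (f x) else 0) (≤ᵇ-false s<x))
        (cong (λ b → if b then chainCount f k (s ∸ x) (f x) else 0) (∧-zeroʳ (1 ≤ᵇ x)))

branch-within : ∀ f k s x → x < s → branch f k s (suc x) ≡ chainCount f k (s ∸ suc x) (f (suc x))
branch-within f k s x x<s = cong (λ b → if b then chainCount f k (s ∸ suc x) (f (suc x)) else 0) (≤ᵇ-true x<s)

chainCount-sum0 : ∀ f k c → chainCount f (suc k) 0 c ≡ 0
chainCount-sum0 f k c = Sum-zero (suc c) (branch f k 0) vanish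
  where
  vanish : ∀ x → x < suc c → branch f k 0 x ≡ 0
  vanish zero    _ = refl
  vanish (suc x) _ = refl

-- A branch with positive first entry x+1 is the count of the remaining chains, also when
-- x+1 exceeds the sum (then both sides vanish).
branch-suc : ∀ f k t y → branch f (suc k) t (suc y) ≡ chainCount f (suc k) (t ∸ suc y) (f (suc y))
branch-suc f k t y with y <? t
... | yes y<t = branch-within f (suc k) t y y<t
... | no  y≮t = trans (branch-beyond f (suc k) t (suc y) (s≤s t≤y))
                      (sym (trans (cong (λ d → chainCount f (suc k) d (f (suc y))) (m≤n⇒m∸n≡0 (m≤n⇒m≤1+n t≤y)))
                                  (chainCount-sum0 f k (f (suc y)))))
  where
  t≤y : t ≤ y
  t≤y = ≮⇒≥ y≮t

-- k positive entries cannot sum to less than k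
chainCount-small : ∀ f k s c → s < k → chainCount f k s c ≡ 0
chainCount-small f (suc k) s c s<k = Sum-zero (suc c) (branch f k s) vanish
  where
  vanish : ∀ x → x < suc c → branch f k s x ≡ 0
  vanish zero    _ = refl
  vanish (suc x) _ with suc x ≤ᵇ s in x<s
  ... | false = refl
  ... | true  = chainCount-small f k (s ∸ suc x) (f (suc x))
                  (<-≤-trans (∸-monoʳ-< {s} {suc x} {0} (s≤s z≤n) (≤ᵇ-sound x<s)) (≤-pred s<k))

-- a cap above the sum constrains nothing
chainCount-cap : ∀ f k s c → s ≤ c → chainCount f k s c ≡ chainCount f k s s
chainCount-cap f zero    zero    c _   = refl
chainCount-cap f zero    (suc s) c _   = refl
chainCount-cap f (suc k) s       c s≤c = Sum-truncate (suc s) (suc c) (branch f k s) (s≤s s≤c) (branch-beyond f k s)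

P≤-one : ∀ t c → P≤ 1 t c ≡ ι ((1 ≤ᵇ t) ∧ (t ≤ᵇ c))
P≤-one zero    c       = chainCount-sum0 id 0 c
P≤-one (suc t) zero    = refl
P≤-one (suc t) (suc c) = trans (cong (_+ branch id 0 (suc t) (suc c)) (P≤-one (suc t) c)) (last (<-cmp t c))
  where
  last : Tri (t < c) (t ≡ c) (c < t) → ι (suc t ≤ᵇ c) + branch id 0 (suc t) (suc c) ≡ ι (suc t ≤ᵇ suc c)
  last (tri< t<c _ _) = trans (cong₂ (λ a b → ι a + b) (≤ᵇ-true t<c) (branch-beyond id 0 (suc t) (suc c) (s≤s t<c)))
                              (cong ι (sym (≤ᵇ-true (m<n⇒m<1+n t<c))))
  last (tri≈ _ refl _) = trans (cong₂ (λ a b → ι a + b) (≤ᵇ-false (n<1+n t)) (branch-within id 0 (suc t) t ≤-refl))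
                               (trans (cong (λ d → chainCount id 0 d (suc t)) (n∸n≡0 t)) (cong ι (sym (≤ᵇ-true (≤-refl {suc t})))))
  last (tri> _ _ c<t) = trans (cong₂ (λ a b → ι a + b) (≤ᵇ-false (m<n⇒m<1+n c<t)) (branch-within id 0 (suc t) c (m<n⇒m<1+n c<t)))
                              (trans (empty (m<n⇒0<n∸m c<t)) (cong ι (sym (≤ᵇ-false (s≤s c<t)))))
    where
    empty : ∀ {d} → 0 < d → chainCount id 0 d (suc c) ≡ 0
    empty {suc d} _ = refl

-- The basic recursion: a partition of s+1 into k+1 parts either has a part equal to 1
-- (remove it) or has all parts ≥ 2 (subtract 1 from each part):
--   P≤ (k+1) (s+1) (c+1) = P≤ k s (c+1) + P≤ (k+1) (s-k) c.

P≤-step : ∀ k s c → P≤ (suc k) (suc s) (suc c) ≡ P≤ k s (suc c) + P≤ (suc k) (s ∸ k) c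

branch-step : ∀ k s x → branch id (suc k) (suc s) (suc x) ≡ branch id k s (suc x) + branch id (suc k) (s ∸ suc k) x

P≤-step zero s c rewrite P≤-one (suc s) (suc c) | P≤-one s c with s
... | zero   = refl
... | suc _  = refl
P≤-step (suc k) s c = begin
    Sum (suc (suc c)) (branch id (suc k) (suc s))
  ≡⟨ Sum-shift (suc c) _ ⟩
    Sum (suc c) (λ x → branch id (suc k) (suc s) (suc x))
  ≡⟨ Sum-cong (suc c) _ _ (λ x _ → branch-step k s x) ⟩
    Sum (suc c) (λ x → branch id k s (suc x) + branch id (suc k) (s ∸ suc k) x)
  ≡⟨ Sum-+ (suc c) _ _ ⟩
    Sum (suc c) (λ x → branch id k s (suc x)) + Sum (suc c) (branch id (suc k) (s ∸ suc k))
  ≡⟨ cong (_+ P≤ (suc (suc k)) (s ∸ suc k) c) (sym (Sum-shift (suc c) (branch id k s))) ⟩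
    P≤ (suc k) s (suc c) + P≤ (suc (suc k)) (s ∸ suc k) c ∎
  where
  open ≡-Reasoning

branch-step k s x with <-cmp x s
... | tri> _ _ s<x = trans (branch-beyond id (suc k) (suc s) (suc x) (s≤s s<x))
                           (sym (cong₂ _+_ (branch-beyond id k s (suc x) (m<n⇒m<1+n s<x))
                                           (branch-beyond id (suc k) (s ∸ suc k) x (≤-<-trans (m∸n≤m s (suc k)) s<x))))
... | tri≈ _ refl _ = trans (branch-within id (suc k) (suc x) x ≤-refl)
                            (trans (cong (λ d → P≤ (suc k) d (suc x)) (n∸n≡0 x))
                                   (trans (chainCount-sum0 id k (suc x))
                                          (sym (cong₂ _+_ (branch-beyond id k x (suc x) ≤-refl) (below-diagonal x)))))
  where
  below-diagonal : ∀ x → branch id (suc k) (x ∸ suc k) x ≡ 0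
  below-diagonal zero    = refl
  below-diagonal (suc x) = branch-beyond id (suc k) (x ∸ k) (suc x) (s≤s (m∸n≤m x k))
... | tri< x<s _ _ = begin
    branch id (suc k) (suc s) (suc x)
  ≡⟨ branch-within id (suc k) (suc s) x (m<n⇒m<1+n x<s) ⟩
    P≤ (suc k) (s ∸ x) (suc x)
  ≡⟨ cong (λ d → P≤ (suc k) d (suc x)) (+-∸-assoc 1 x<s) ⟩
    P≤ (suc k) (suc (s ∸ suc x)) (suc x)
  ≡⟨ P≤-step k (s ∸ suc x) x ⟩
    P≤ k (s ∸ suc x) (suc x) + P≤ (suc k) (s ∸ suc x ∸ k) x
  ≡⟨ cong₂ _+_ (sym (branch-within id k s x x<s)) (shifted x) ⟩
    branch id k s (suc x) + branch id (suc k) (s ∸ suc k) x ∎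
  where
  open ≡-Reasoning
  reorder : ∀ y → s ∸ suc (suc y) ∸ k ≡ s ∸ suc k ∸ suc y
  reorder y = trans (∸-+-assoc s (suc (suc y)) k)
                    (trans (cong (λ z → s ∸ suc z) (trans (cong suc (+-comm y k)) (sym (+-suc k y))))
                           (sym (∸-+-assoc s (suc k) (suc y))))
  -- the partitions with every part lowered by one
  shifted : ∀ x → P≤ (suc k) (s ∸ suc x ∸ k) x ≡ branch id (suc k) (s ∸ suc k) x
  shifted zero    = refl
  shifted (suc y) = trans (cong (λ d → P≤ (suc k) d (suc y)) (reorder y)) (sym (branch-suc id k (s ∸ suc k) y))

chainCount-length0 : ∀ f g t c c' → chainCount f 0 t c ≡ chainCount g 0 t c'
chainCount-length0 f g zero    c c' = refl
chainCount-length0 f g (suc t) c c' = refl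

-- Δ k = 0 + 1 + … + (k-1), the sum of the staircase (k-1, …, 1, 0)
Δ : ℕ → ℕ
Δ zero    = 0
Δ (suc k) = Δ k + k

StaircaseFor : ℕ → Set
StaircaseFor k = ∀ s c → chainCount pred (suc k) s c ≡ P≤ (suc k) (s ∸ Δ (suc k)) (c ∸ k)

-- a first entry x ≤ k leaves no room for k+1 smaller distinct parts
staircase-low : ∀ k → StaircaseFor k → ∀ s x → x ≤ k → branch pred (suc k) s x ≡ 0
staircase-low k hyp s zero    _   = refl
staircase-low k hyp s (suc x) x<k = trans (branch-suc pred k s x)
                                          (trans (hyp (s ∸ suc x) x) (cong (P≤ (suc k) _) (m≤n⇒m∸n≡0 (<⇒≤ x<k))))

-- One more part: a distinct chain of length k+2 with first entry x leaves a distinct chain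
-- of length k+1 below x-1, which the hypothesis for k+1 turns into a non-increasing one.
staircase-step : ∀ k → StaircaseFor k → ∀ s c → chainCount pred (suc (suc k)) s c ≡ P≤ (suc (suc k)) (s ∸ Δ (suc (suc k))) (c ∸ suc k)
staircase-step k hyp s c with c ≤? k
... | yes c≤k rewrite m≤n⇒m∸n≡0 (≤-trans c≤k (n≤1+n k)) = Sum-zero (suc c) _ (λ x x≤c → staircase-low k hyp s x (≤-trans (≤-pred x≤c) c≤k))
... | no c≰k = begin
    Sum (suc c) (branch pred K s)
  ≡⟨ cong (λ z → Sum z (branch pred K s)) (trans (cong suc (sym (m+[n∸m]≡n (≰⇒> c≰k)))) (sym (+-suc K c'))) ⟩
    Sum (K + suc c') (branch pred K s)
  ≡⟨ Sum-split K (suc c') (branch pred K s) ⟩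
    Sum K (branch pred K s) + Sum (suc c') (λ y → branch pred K s (K + y))
  ≡⟨ cong₂ _+_ (Sum-zero K _ (λ x x<K → staircase-low k hyp s x (≤-pred x<K))) (Sum-cong (suc c') _ _ (λ y _ → shifted y)) ⟩
    P≤ (suc K) (s ∸ Δ (suc K)) c' ∎
  where
  open ≡-Reasoning
  K : ℕ
  K  = suc k
  c' : ℕ
  c' = c ∸ K
  -- first entries K+y of distinct chains correspond to first entries y after subtracting the staircase
  shifted : ∀ y → branch pred K s (K + y) ≡ branch id K (s ∸ Δ (suc K)) y
  shifted zero    = trans (branch-suc pred k s (k + 0))
                          (trans (hyp (s ∸ suc (k + 0)) (k + 0)) (cong (P≤ K _) (m+n∸m≡n k 0)))
  shifted (suc y) = trans (branch-suc pred k s (k + suc y))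
                          (trans (hyp (s ∸ suc (k + suc y)) (k + suc y))
                                 (trans (cong₂ (P≤ K) reorder (m+n∸m≡n k (suc y))) (sym (branch-suc id k (s ∸ Δ (suc K)) y))))
    where
    reorder : s ∸ suc (k + suc y) ∸ Δ K ≡ s ∸ Δ (suc K) ∸ suc y
    reorder = trans (∸-+-assoc s (suc (k + suc y)) (Δ K))
                    (trans (cong (s ∸_) (trans (+-comm (K + suc y) (Δ K)) (sym (+-assoc (Δ K) K (suc y)))))
                           (sym (∸-+-assoc s (Δ K + K) (suc y))))

-- Subtracting the staircase turns strictly decreasing chains into non-increasing ones:
-- distinct partitions of s into k parts ≤ c ↔ partitions of s - Δ k into k parts ≤ c - (k-1).
staircase : ∀ k s c → chainCount pred k s c ≡ P≤ k (s ∸ Δ k) (c ∸ pred k)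
staircase zero          s c = chainCount-length0 pred id s c c
staircase (suc zero)    s c = Sum-cong (suc c) _ _ (λ x _ → cong (λ n → if (1 ≤ᵇ x) ∧ (x ≤ᵇ s) then n else 0)
                                                            (chainCount-length0 pred id (s ∸ x) (pred x) x))
staircase (suc (suc k)) = staircase-step k (staircase (suc k))

pred≤Δ : ∀ k → pred k ≤ Δ k
pred≤Δ zero          = z≤n
pred≤Δ (suc zero)    = z≤n
pred≤Δ (suc (suc k)) = m≤n+m (suc k) (Δ (suc k))

q≡P : ∀ n k → q n k ≡ P k (n ∸ Δ k)
q≡P n k = trans (q≡chainCount n k) (trans (staircase k n n) (chainCount-cap id k (n ∸ Δ k) (n ∸ pred k) (∸-monoʳ-≤ n (pred≤Δ k))))

P-rec : ∀ k s → P (suc k) (suc s) ≡ P k s + P (suc k) (s ∸ k)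
P-rec k s = trans (P≤-step k s s) (cong₂ _+_ (chainCount-cap id k s (suc s) (n≤1+n s))
                                              (chainCount-cap id (suc k) (s ∸ k) s (m∸n≤m s k)))

P-small : ∀ k s → s < k → P k s ≡ 0
P-small k s = chainCount-small id k s s

P-one : ∀ s → P 1 (suc s) ≡ 1
P-one zero    = refl
P-one (suc s) = trans (P-rec 0 (suc s)) (P-one s)

-- P (k+1) is monotone in the sum: add 1 to the largest part
P-mono-suc : ∀ k s → P (suc k) s ≤ P (suc k) (suc s)
P-mono-suc zero    s = subst (P 1 s ≤_) (sym (P-rec 0 s)) (m≤n+m (P 1 s) (P 0 s))
P-mono-suc (suc k) s = <-rec (λ s → P (suc (suc k)) s ≤ P (suc (suc k)) (suc s)) step s
  where
  step : ∀ s → (∀ {t} → t < s → P (suc (suc k)) t ≤ P (suc (suc k)) (suc t)) → P (suc (suc k)) s ≤ P (suc (suc k)) (suc s)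
  step zero    _  = subst (_≤ P (suc (suc k)) 1) (sym (chainCount-sum0 id (suc k) 0)) z≤n
  step (suc s) ih rewrite P-rec (suc k) s | P-rec (suc k) (suc s) = +-mono-≤ (P-mono-suc k s) lowered
    where
    lowered : P (suc (suc k)) (s ∸ suc k) ≤ P (suc (suc k)) (s ∸ k)
    lowered with k <? s
    ... | yes k<s = subst (λ d → P (suc (suc k)) (s ∸ suc k) ≤ P (suc (suc k)) d) (sym (+-∸-assoc 1 k<s))
                          (ih (s≤s (m∸n≤m s (suc k))))
    ... | no  k≮s rewrite m≤n⇒m∸n≡0 (≮⇒≥ k≮s) | m≤n⇒m∸n≡0 (≤-trans (≮⇒≥ k≮s) (n≤1+n k)) = ≤-refl

P-mono : ∀ k {a b} → a ≤ b → P (suc k) a ≤ P (suc k) b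
P-mono k {a} {b} a≤b = subst (λ z → P (suc k) a ≤ P (suc k) z) (m+[n∸m]≡n a≤b) (go (b ∸ a))
  where
  go : ∀ d → P (suc k) a ≤ P (suc k) (a + d)
  go zero    = ≤-reflexive (cong (P (suc k)) (sym (+-identityʳ a)))
  go (suc d) = ≤-trans (go d) (subst (λ z → P (suc k) (a + d) ≤ P (suc k) z) (sym (+-suc a d)) (P-mono-suc k (a + d)))

q≤p : ∀ n k → q n k ≤ p n k
q≤p n zero    = ≤-reflexive (trans (q≡P n 0) (sym (p≡P n 0)))
q≤p n (suc k) rewrite q≡P n (suc k) | p≡P n (suc k) = P-mono k (m∸n≤m n (Δ (suc k)))

-- Rising factorials  rise a r = (a+1)(a+2)⋯(a+r),  which approximate P (r+1) (a+r+1)·(r+1)!r!.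

rise : ℕ → ℕ → ℕ
rise a zero    = 1
rise a (suc r) = rise a r * (a + suc r)

rise-pos : ∀ a r → 1 ≤ rise a r
rise-pos a zero    = ≤-refl
rise-pos a (suc r) = *-mono-≤ (rise-pos a r) (≤-trans (s≤s z≤n) (m≤n+m (suc r) a))

rise-shift : ∀ a r → rise (suc a) r * suc a ≡ rise a r * (a + suc r)
rise-shift a zero    = trans (*-identityˡ (suc a)) (trans (+-comm 1 a) (sym (*-identityˡ (a + 1))))
rise-shift a (suc r) = begin
    rise (suc a) r * (suc a + suc r) * suc a
  ≡⟨ swap (rise (suc a) r) (suc a + suc r) (suc a) ⟩
    rise (suc a) r * suc a * (suc a + suc r)
  ≡⟨ cong (_* (suc a + suc r)) (rise-shift a r) ⟩
    rise a r * (a + suc r) * (suc a + suc r)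
  ≡⟨ cong (rise a r * (a + suc r) *_) (sym (+-suc a (suc r))) ⟩
    rise a r * (a + suc r) * (a + suc (suc r)) ∎
  where
  open ≡-Reasoning
  swap : ∀ x y z → x * y * z ≡ x * z * y
  swap = solve-∀

rise-step : ∀ a r → rise (suc a) (suc r) ≡ rise a (suc r) + suc r * rise (suc a) r
rise-step a r = begin
    rise (suc a) r * (suc a + suc r)
  ≡⟨ expand (rise (suc a) r) a r ⟩
    rise (suc a) r * suc a + suc r * rise (suc a) r
  ≡⟨ cong (_+ suc r * rise (suc a) r) (rise-shift a r) ⟩
    rise a r * (a + suc r) + suc r * rise (suc a) r ∎
  where
  open ≡-Reasoning
  expand : ∀ x a r → x * (suc a + suc r) ≡ x * suc a + suc r * x
  expand = solve-∀

rise-mono-suc : ∀ a r → rise a r ≤ rise (suc a) r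
rise-mono-suc a zero    = ≤-refl
rise-mono-suc a (suc r) = subst (rise a (suc r) ≤_) (sym (rise-step a r)) (m≤m+n _ _)

rise-mono : ∀ r {a b} → a ≤ b → rise a r ≤ rise b r
rise-mono r {a} {b} a≤b = subst (λ z → rise a r ≤ rise z r) (m+[n∸m]≡n a≤b) (go (b ∸ a))
  where
  go : ∀ d → rise a r ≤ rise (a + d) r
  go zero    = ≤-reflexive (cong (λ z → rise z r) (sym (+-identityʳ a)))
  go (suc d) = ≤-trans (go d) (subst (λ z → rise (a + d) r ≤ rise z r) (sym (+-suc a d)) (rise-mono-suc (a + d) r))

rise-shift-≤ : ∀ a r j → rise (a + j) (suc r) ≤ rise a (suc r) + j * suc r * rise (a + j) r
rise-shift-≤ a r zero    = ≤-reflexive (trans (cong (λ z → rise z (suc r)) (+-identityʳ a)) (sym (+-identityʳ _)))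
rise-shift-≤ a r (suc j) rewrite +-suc a j | rise-step (a + j) r = begin
    rise (a + j) (suc r) + suc r * rise (suc (a + j)) r
  ≤⟨ +-monoˡ-≤ _ (rise-shift-≤ a r j) ⟩
    rise a (suc r) + j * suc r * rise (a + j) r + suc r * rise (suc (a + j)) r
  ≤⟨ +-monoˡ-≤ _ (+-monoʳ-≤ (rise a (suc r)) (*-monoʳ-≤ (j * suc r) (rise-mono-suc (a + j) r))) ⟩
    rise a (suc r) + j * suc r * rise (suc (a + j)) r + suc r * rise (suc (a + j)) r
  ≡⟨ collect (rise a (suc r)) j r (rise (suc (a + j)) r) ⟩
    rise a (suc r) + suc j * suc r * rise (suc (a + j)) r ∎
  where
  open ≤-Reasoning
  collect : ∀ x j r y → x + j * suc r * y + suc r * y ≡ x + suc j * suc r * y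
  collect = solve-∀

rise-shift-≥ : ∀ a r j → rise a (suc r) + j * suc r * rise (suc a) r ≤ rise (a + j) (suc r)
rise-shift-≥ a r zero    = ≤-reflexive (trans (+-identityʳ _) (cong (λ z → rise z (suc r)) (sym (+-identityʳ a))))
rise-shift-≥ a r (suc j) rewrite +-suc a j | rise-step (a + j) r = begin
    rise a (suc r) + suc j * suc r * rise (suc a) r
  ≡⟨ split (rise a (suc r)) j r (rise (suc a) r) ⟩
    rise a (suc r) + j * suc r * rise (suc a) r + suc r * rise (suc a) r
  ≤⟨ +-mono-≤ (rise-shift-≥ a r j) (*-monoʳ-≤ (suc r) (rise-mono r (s≤s (m≤m+n a j)))) ⟩
    rise (a + j) (suc r) + suc r * rise (suc (a + j)) r ∎
  where
  open ≤-Reasoning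
  split : ∀ x j r y → x + suc j * suc r * y ≡ x + j * suc r * y + suc r * y
  split = solve-∀

-- P₀ k m = P k (m+k): partitions of m into k non-negative parts (add 1 to every part).
P₀ : ℕ → ℕ → ℕ
P₀ k m = P k (m + k)

P₀-rec : ∀ k m → P₀ (suc k) m ≡ P₀ k m + P (suc k) m
P₀-rec k m = trans (cong (P (suc k)) (+-suc m k)) (trans (P-rec k (m + k)) (cong (λ z → P₀ k m + P (suc k) z) (m+n∸n≡m m k)))

P₀-one : ∀ m → P₀ 1 m ≡ 1
P₀-one m = trans (cong (P 1) (+-comm m 1)) (P-one m)

-- (k+1)! k!, the normalisation in  P₀ (k+1) m ≈ m^k / ((k+1)! k!)
dfac : ℕ → ℕ
dfac zero    = 1
dfac (suc k) = suc (suc k) * suc k * dfac k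

dfac-pos : ∀ k → 1 ≤ dfac k
dfac-pos zero    = ≤-refl
dfac-pos (suc k) = *-mono-≤ (s≤s (z≤n {k + suc k * suc k})) (dfac-pos k)

induction-by-steps : ∀ K (Q : ℕ → Set) → (∀ m → m ≤ K → Q m) → (∀ t → Q t → Q (t + suc K)) → ∀ m → Q m
induction-by-steps K Q base step = <-rec Q go
  where
  go : ∀ m → (∀ {t} → t < m → Q t) → Q m
  go m ih with m ≤? K
  ... | yes m≤K = base m m≤K
  ... | no  m≰K = subst Q (m∸n+n≡m (≰⇒> m≰K)) (step (m ∸ suc K) (ih (∸-monoʳ-< {m} {suc K} {0} (s≤s z≤n) (≰⇒> m≰K))))

-- For m ≤ k+1 there are no partitions of m into k+2 positive parts, so
-- P₀ (k+2) m = P₀ (k+1) m; and for larger m, P₀ (k+2) (t+k+2) = P₀ (k+1) (t+k+2) + P₀ (k+2) t.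
P₀-few : ∀ k m → m ≤ suc k → P₀ (suc (suc k)) m ≡ P₀ (suc k) m
P₀-few k m m≤k+1 = trans (P₀-rec (suc k) m) (trans (cong (P₀ (suc k) m +_) (P-small (suc (suc k)) m (s≤s m≤k+1))) (+-identityʳ _))

P₀-many : ∀ k t → P₀ (suc (suc k)) (t + suc (suc k)) ≡ P₀ (suc k) (t + suc (suc k)) + P₀ (suc (suc k)) t
P₀-many k t = P₀-rec (suc k) (t + suc (suc k))

rise≤P₀ : ∀ k m → rise m k ≤ dfac k * P₀ (suc k) m
rise≤P₀ zero    m = ≤-reflexive (sym (trans (+-identityʳ _) (P₀-one m)))
rise≤P₀ (suc k)   = induction-by-steps (suc k) (λ m → rise m (suc k) ≤ dfac (suc k) * P₀ K2 m) few many
  where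
  K2 : ℕ
  K2 = suc (suc k)
  few : ∀ m → m ≤ suc k → rise m (suc k) ≤ dfac (suc k) * P₀ K2 m
  few m m≤k+1 = begin
      rise m k * (m + suc k)
    ≤⟨ *-mono-≤ (rise≤P₀ k m) (≤-trans (+-monoˡ-≤ (suc k) m≤k+1) (double≤ k)) ⟩
      dfac k * P₀ (suc k) m * (K2 * suc k)
    ≡⟨ reorder (dfac k) (P₀ (suc k) m) k ⟩
      K2 * suc k * dfac k * P₀ (suc k) m
    ≡⟨ cong (dfac (suc k) *_) (sym (P₀-few k m m≤k+1)) ⟩
      dfac (suc k) * P₀ K2 m ∎
    where
    open ≤-Reasoning
    double≤ : ∀ k → suc k + suc k ≤ suc (suc k) * suc k
    double≤ k = subst (suc k + suc k ≤_) (expand k) (m≤m+n (suc k + suc k) (k * suc k))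
      where
      expand : ∀ k → suc k + suc k + k * suc k ≡ suc (suc k) * suc k
      expand = solve-∀
    reorder : ∀ c x k → c * x * (suc (suc k) * suc k) ≡ suc (suc k) * suc k * c * x
    reorder = solve-∀
  many : ∀ t → rise t (suc k) ≤ dfac (suc k) * P₀ K2 t → rise (t + K2) (suc k) ≤ dfac (suc k) * P₀ K2 (t + K2)
  many t ih = begin
      rise (t + K2) (suc k)
    ≤⟨ rise-shift-≤ t k K2 ⟩
      rise t (suc k) + K2 * suc k * rise (t + K2) k
    ≤⟨ +-mono-≤ ih (*-monoʳ-≤ (K2 * suc k) (rise≤P₀ k (t + K2))) ⟩
      dfac (suc k) * P₀ K2 t + K2 * suc k * (dfac k * P₀ (suc k) (t + K2))
    ≡⟨ collect (dfac k) (P₀ K2 t) (P₀ (suc k) (t + K2)) k ⟩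
      dfac (suc k) * (P₀ (suc k) (t + K2) + P₀ K2 t)
    ≡⟨ cong (dfac (suc k) *_) (sym (P₀-many k t)) ⟩
      dfac (suc k) * P₀ K2 (t + K2) ∎
    where
    open ≤-Reasoning
    collect : ∀ c x y k → suc (suc k) * suc k * c * x + suc (suc k) * suc k * (c * y) ≡ suc (suc k) * suc k * c * (y + x)
    collect = solve-∀

P₀≤rise : ∀ k m → dfac k * P₀ (suc k) m ≤ rise (m + Δ (suc k)) k
P₀≤rise zero    m = ≤-reflexive (trans (+-identityʳ _) (P₀-one m))
P₀≤rise (suc k)   = induction-by-steps (suc k) (λ m → dfac (suc k) * P₀ K2 m ≤ rise (m + Δ K2) (suc k)) few many
  where
  K2 : ℕ
  K2 = suc (suc k)
  few : ∀ m → m ≤ suc k → dfac (suc k) * P₀ K2 m ≤ rise (m + Δ K2) (suc k)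
  few m m≤k+1 = begin
      dfac (suc k) * P₀ K2 m
    ≡⟨ cong (dfac (suc k) *_) (P₀-few k m m≤k+1) ⟩
      K2 * suc k * dfac k * P₀ (suc k) m
    ≡⟨ *-assoc (K2 * suc k) (dfac k) (P₀ (suc k) m) ⟩
      K2 * suc k * (dfac k * P₀ (suc k) m)
    ≤⟨ *-monoʳ-≤ (K2 * suc k) (P₀≤rise k m) ⟩
      K2 * suc k * rise y k
    ≡⟨ split (rise y k) k ⟩
      suc k * rise y k + suc k * suc k * rise y k
    ≤⟨ +-mono-≤ (subst (_≤ rise y (suc k)) (*-comm (rise y k) (suc k)) (*-monoʳ-≤ (rise y k) (m≤n+m (suc k) y)))
                (*-monoʳ-≤ (suc k * suc k) (rise-mono-suc y k)) ⟩
      rise y (suc k) + suc k * suc k * rise (suc y) k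
    ≤⟨ rise-shift-≥ y k (suc k) ⟩
      rise (y + suc k) (suc k)
    ≡⟨ cong (λ z → rise z (suc k)) (+-assoc m (Δ (suc k)) (suc k)) ⟩
      rise (m + Δ K2) (suc k) ∎
    where
    open ≤-Reasoning
    y : ℕ
    y = m + Δ (suc k)
    split : ∀ x k → suc (suc k) * suc k * x ≡ suc k * x + suc k * suc k * x
    split = solve-∀
  many : ∀ t → dfac (suc k) * P₀ K2 t ≤ rise (t + Δ K2) (suc k) → dfac (suc k) * P₀ K2 (t + K2) ≤ rise (t + K2 + Δ K2) (suc k)
  many t ih = begin
      dfac (suc k) * P₀ K2 (t + K2)
    ≡⟨ cong (dfac (suc k) *_) (P₀-many k t) ⟩
      dfac (suc k) * (P₀ (suc k) (t + K2) + P₀ K2 t)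
    ≡⟨ distribute (dfac k) (P₀ (suc k) (t + K2)) (P₀ K2 t) k ⟩
      K2 * suc k * (dfac k * P₀ (suc k) (t + K2)) + dfac (suc k) * P₀ K2 t
    ≤⟨ +-mono-≤ (*-monoʳ-≤ (K2 * suc k) (P₀≤rise k (t + K2))) ih ⟩
      K2 * suc k * rise (t + K2 + Δ (suc k)) k + rise z (suc k)
    ≡⟨ cong (λ w → K2 * suc k * rise w k + rise z (suc k)) (shift1 t (Δ (suc k)) k) ⟩
      K2 * suc k * rise (suc z) k + rise z (suc k)
    ≡⟨ +-comm _ (rise z (suc k)) ⟩
      rise z (suc k) + K2 * suc k * rise (suc z) k
    ≤⟨ rise-shift-≥ z k K2 ⟩
      rise (z + K2) (suc k)
    ≡⟨ cong (λ w → rise w (suc k)) (shift2 t (Δ (suc k)) k) ⟩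
      rise (t + K2 + Δ K2) (suc k) ∎
    where
    open ≤-Reasoning
    z : ℕ
    z = t + Δ K2
    distribute : ∀ c x y k → suc (suc k) * suc k * c * (x + y) ≡ suc (suc k) * suc k * (c * x) + suc (suc k) * suc k * c * y
    distribute = solve-∀
    shift1 : ∀ t d k → t + suc (suc k) + d ≡ suc (t + (d + suc k))
    shift1 = solve-∀
    shift2 : ∀ t d k → t + (d + suc k) + suc (suc k) ≡ t + suc (suc k) + (d + suc k)
    shift2 = solve-∀

P₀-pos : ∀ k m → 1 ≤ P₀ (suc k) m
P₀-pos k m with P₀ (suc k) m | rise≤P₀ k m
... | zero  | le = ⊥-elim (<⇒≱ (rise-pos m k) (≤-trans le (≤-reflexive (*-zeroʳ (dfac k)))))
... | suc _ | _  = s≤s z≤n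

p-pos : ∀ n k → 1 ≤ k → k ≤ n → 1 ≤ p n k
p-pos n (suc k) _ k≤n rewrite p≡P n (suc k) = subst (λ w → 1 ≤ P (suc k) w) (m∸n+n≡m k≤n) (P₀-pos k (n ∸ suc k))

cancel-*ʳ : ∀ m n o → 1 ≤ o → m * o ≤ n * o → m ≤ n
cancel-*ʳ m n (suc o) _ le = *-cancelʳ-≤ m n (suc o) le

bernoulli-step : ∀ a b c → (a + b) * (a ∸ (b + c)) ≤ a * (a ∸ c)
bernoulli-step a b c with b + c ≤? a
... | no  b+c≰a rewrite m≤n⇒m∸n≡0 (<⇒≤ (≰⇒> b+c≰a)) | *-zeroʳ (a + b) = z≤n
... | yes b+c≤a = subst₂ _≤_ (sym lhs) (sym rhs) (m≤m+n _ _)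
  where
  e : ℕ
  e = a ∸ (b + c)
  a≡ : b + c + e ≡ a
  a≡ = m+[n∸m]≡n b+c≤a
  lhs : (a + b) * (a ∸ (b + c)) ≡ (b + c + e + b) * e
  lhs = cong (λ z → (z + b) * e) (sym a≡)
  rhs : a * (a ∸ c) ≡ (b + c + e + b) * e + (b * b + c * b)
  rhs = trans (cong₂ _*_ (sym a≡) (trans (cong (_∸ c) (sym a≡)) (cancel-c b c e))) (expand b c e)
    where
    cancel-c : ∀ b c e → b + c + e ∸ c ≡ b + e
    cancel-c b c e = trans (cong (_∸ c) (solve-c b c e)) (m+n∸n≡m (b + e) c)
      where
      solve-c : ∀ b c e → b + c + e ≡ b + e + c
      solve-c = solve-∀
    expand : ∀ b c e → (b + c + e) * (b + e) ≡ (b + c + e + b) * e + (b * b + c * b)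
    expand = solve-∀

bernoulli : ∀ a b r → (a + b) ^ r * (a ∸ r * b) ≤ a ^ suc r
bernoulli a b zero    = ≤-reflexive (trans (+-identityʳ _) (sym (*-identityʳ a)))
bernoulli a b (suc r) = begin
    (a + b) * (a + b) ^ r * (a ∸ (b + r * b))
  ≡⟨ swap (a + b) ((a + b) ^ r) (a ∸ (b + r * b)) ⟩
    (a + b) ^ r * ((a + b) * (a ∸ (b + r * b)))
  ≤⟨ *-monoʳ-≤ ((a + b) ^ r) (bernoulli-step a b (r * b)) ⟩
    (a + b) ^ r * (a * (a ∸ r * b))
  ≡⟨ swap′ ((a + b) ^ r) a (a ∸ r * b) ⟩
    a * ((a + b) ^ r * (a ∸ r * b))
  ≤⟨ *-monoʳ-≤ a (bernoulli a b r) ⟩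
    a * a ^ suc r ∎
  where
  open ≤-Reasoning
  swap : ∀ x y z → x * y * z ≡ y * (x * z)
  swap = solve-∀
  swap′ : ∀ x y z → x * (y * z) ≡ y * (x * z)
  swap′ = solve-∀

power-double : ∀ a b r → 1 ≤ a → 2 * (r * b) ≤ a → (a + b) ^ r ≤ 2 * a ^ r
power-double a b r 1≤a 2rb≤a = cancel-*ʳ _ _ a 1≤a (begin
    (a + b) ^ r * a
  ≤⟨ *-monoʳ-≤ ((a + b) ^ r) a≤2x ⟩
    (a + b) ^ r * (2 * x)
  ≡⟨ swap ((a + b) ^ r) x ⟩
    2 * ((a + b) ^ r * x)
  ≤⟨ *-monoʳ-≤ 2 (bernoulli a b r) ⟩
    2 * (a * a ^ r)
  ≡⟨ swap′ a (a ^ r) ⟩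
    2 * a ^ r * a ∎)
  where
  open ≤-Reasoning
  x : ℕ
  x = a ∸ r * b
  twice : ∀ y → 2 * y ≡ y + y
  twice y = cong (y +_) (+-identityʳ y)
  rb+rb≤a : r * b + r * b ≤ a
  rb+rb≤a = subst (_≤ a) (twice (r * b)) 2rb≤a
  rb≤x : r * b ≤ x
  rb≤x = subst (_≤ x) (m+n∸n≡m (r * b) (r * b)) (∸-monoˡ-≤ (r * b) rb+rb≤a)
  a≤2x : a ≤ 2 * x
  a≤2x = subst₂ _≤_ (m∸n+n≡m (≤-trans (m≤m+n (r * b) (r * b)) rb+rb≤a)) (sym (twice x)) (+-monoʳ-≤ x rb≤x)
  swap : ∀ y x → y * (2 * x) ≡ 2 * (y * x)
  swap = solve-∀
  swap′ : ∀ a y → 2 * (a * y) ≡ 2 * y * a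
  swap′ = solve-∀

rise-vs-power : ∀ m s r → rise (m + s) r * suc m ^ r ≤ rise m r * (suc m + s) ^ r
rise-vs-power m s zero    = ≤-refl
rise-vs-power m s (suc r) = begin
    rise (m + s) r * (m + s + suc r) * (suc m * suc m ^ r)
  ≡⟨ regroup (rise (m + s) r) (m + s + suc r) (suc m) (suc m ^ r) ⟩
    (rise (m + s) r * suc m ^ r) * ((m + s + suc r) * suc m)
  ≤⟨ *-mono-≤ (rise-vs-power m s r) factor ⟩
    (rise m r * (suc m + s) ^ r) * ((m + suc r) * (suc m + s))
  ≡⟨ regroup′ (rise m r) ((suc m + s) ^ r) (m + suc r) (suc m + s) ⟩
    rise m r * (m + suc r) * ((suc m + s) * (suc m + s) ^ r) ∎
  where
  open ≤-Reasoning
  regroup : ∀ x u v y → x * u * (v * y) ≡ (x * y) * (u * v)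
  regroup = solve-∀
  regroup′ : ∀ x y u v → (x * y) * (u * v) ≡ x * u * (v * y)
  regroup′ = solve-∀
  -- (m+s+r+1)(m+1) ≤ (m+r+1)(m+1+s), the difference being r s
  factor : (m + s + suc r) * suc m ≤ (m + suc r) * (suc m + s)
  factor = subst ((m + s + suc r) * suc m ≤_) (sym (expand m s r)) (m≤m+n _ (r * s))
    where
    expand : ∀ m s r → (m + suc r) * (suc m + s) ≡ (m + s + suc r) * suc m + r * s
    expand = solve-∀

rise-double : ∀ m s r → 2 * (r * s) ≤ suc m → rise (m + s) r ≤ 2 * rise m r
rise-double m s r 2rs≤m+1 = cancel-*ʳ _ _ (suc m ^ r) (power-pos r) (begin
    rise (m + s) r * suc m ^ r
  ≤⟨ rise-vs-power m s r ⟩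
    rise m r * (suc m + s) ^ r
  ≤⟨ *-monoʳ-≤ (rise m r) (power-double (suc m) s r (s≤s z≤n) 2rs≤m+1) ⟩
    rise m r * (2 * suc m ^ r)
  ≡⟨ swap (rise m r) (suc m ^ r) ⟩
    2 * rise m r * suc m ^ r ∎)
  where
  open ≤-Reasoning
  power-pos : ∀ r → 1 ≤ suc m ^ r
  power-pos zero    = ≤-refl
  power-pos (suc r) = *-mono-≤ (s≤s (z≤n {m})) (power-pos r)
  swap : ∀ x y → x * (2 * y) ≡ 2 * x * y
  swap = solve-∀

-- The key ratio estimate: one part fewer costs a factor ≈ k²/m,
--   m · P₀ (k+1) m ≤ 2 (k+2)(k+1) · P₀ (k+2) m   whenever 2 k Δ(k+1) ≤ m+1,
-- by sandwiching both sides between rising factorials.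
P₀-ratio : ∀ k m → 2 * (k * Δ (suc k)) ≤ suc m → m * P₀ (suc k) m ≤ 2 * (suc (suc k) * suc k) * P₀ (suc (suc k)) m
P₀-ratio k m cond = cancel-*ʳ _ _ (dfac (suc k)) (dfac-pos (suc k)) (begin
    m * P₀ (suc k) m * dfac (suc k)
  ≡⟨ e1 m (P₀ (suc k) m) (dfac k) k ⟩
    K2 * suc k * m * (dfac k * P₀ (suc k) m)
  ≤⟨ *-monoʳ-≤ (K2 * suc k * m) (P₀≤rise k m) ⟩
    K2 * suc k * m * rise (m + Δ (suc k)) k
  ≤⟨ *-monoʳ-≤ (K2 * suc k * m) (rise-double m (Δ (suc k)) k cond) ⟩
    K2 * suc k * m * (2 * rise m k)
  ≡⟨ e2 (K2 * suc k) m (rise m k) ⟩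
    2 * (K2 * suc k) * (m * rise m k)
  ≤⟨ *-monoʳ-≤ (2 * (K2 * suc k)) m·rise≤rise ⟩
    2 * (K2 * suc k) * rise m (suc k)
  ≤⟨ *-monoʳ-≤ (2 * (K2 * suc k)) (rise≤P₀ (suc k) m) ⟩
    2 * (K2 * suc k) * (dfac (suc k) * P₀ K2 m)
  ≡⟨ e3 (2 * (K2 * suc k)) (dfac (suc k)) (P₀ K2 m) ⟩
    2 * (K2 * suc k) * P₀ K2 m * dfac (suc k) ∎)
  where
  open ≤-Reasoning
  K2 : ℕ
  K2 = suc (suc k)
  m·rise≤rise : m * rise m k ≤ rise m (suc k)
  m·rise≤rise = subst (_≤ rise m (suc k)) (*-comm (rise m k) m) (*-monoʳ-≤ (rise m k) (m≤m+n m (suc k)))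
  e1 : ∀ m x c k → m * x * (suc (suc k) * suc k * c) ≡ suc (suc k) * suc k * m * (c * x)
  e1 = solve-∀
  e2 : ∀ q m y → q * m * (2 * y) ≡ 2 * q * (m * y)
  e2 = solve-∀
  e3 : ∀ q c x → q * (c * x) ≡ q * x * c
  e3 = solve-∀

P-peel : ∀ k r y → P (suc (suc k)) y ≤ P (suc (suc k)) (y ∸ r * suc (suc k)) + r * P (suc k) (pred y)
P-peel k zero    y = m≤m+n _ _
P-peel k (suc r) y = begin
    P K y
  ≤⟨ P-peel k r y ⟩
    P K z + r * P (suc k) (pred y)
  ≤⟨ +-monoˡ-≤ _ (once z) ⟩
    P K (z ∸ K) + P (suc k) (pred z) + r * P (suc k) (pred y)
  ≤⟨ +-monoˡ-≤ _ (+-monoʳ-≤ (P K (z ∸ K)) (P-mono k (pred-mono-≤ (m∸n≤m y (r * K))))) ⟩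
    P K (z ∸ K) + P (suc k) (pred y) + r * P (suc k) (pred y)
  ≡⟨ +-assoc (P K (z ∸ K)) _ _ ⟩
    P K (z ∸ K) + suc r * P (suc k) (pred y)
  ≡⟨ cong (λ w → P K w + suc r * P (suc k) (pred y)) (trans (∸-+-assoc y (r * K) K) (cong (y ∸_) (+-comm (r * K) K))) ⟩
    P K (y ∸ suc r * K) + suc r * P (suc k) (pred y) ∎
  where
  open ≤-Reasoning
  K : ℕ
  K = suc (suc k)
  z : ℕ
  z = y ∸ r * K
  once : ∀ z → P K z ≤ P K (z ∸ K) + P (suc k) (pred z)
  once zero    = z≤n
  once (suc z) = ≤-reflexive (trans (P-rec (suc k) z) (+-comm (P (suc k) z) _))

Δ≤square : ∀ k → Δ k ≤ k * k
Δ≤square zero    = z≤n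
Δ≤square (suc k) = ≤-trans (+-monoˡ-≤ k (Δ≤square k)) (subst (k * k + k ≤_) (sym (expand k)) (m≤m+n _ _))
  where
  expand : ∀ k → suc k * suc k ≡ k * k + k + suc k
  expand = solve-∀

-- For n = m+K, the difference p - q = P K n - P K (n - Δ K) is covered by K peeled-off
-- terms:  P K n - P K (n - Δ K) ≤ K · P₀ (K-1) m.
deficit≤ : ∀ k m → let K = suc (suc k) in P K (m + K) ∸ P K (m + K ∸ Δ K) ≤ K * P₀ (suc k) m
deficit≤ k m = subst (P K n ∸ P K (n ∸ Δ K) ≤_) (m+n∸m≡n (P K (n ∸ Δ K)) (K * P₀ (suc k) m)) (∸-monoˡ-≤ (P K (n ∸ Δ K)) (begin
    P K n
  ≤⟨ P-peel k K n ⟩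
    P K (n ∸ K * K) + K * P (suc k) (pred n)
  ≤⟨ +-monoˡ-≤ _ (P-mono (suc k) (∸-monoʳ-≤ n (Δ≤square K))) ⟩
    P K (n ∸ Δ K) + K * P (suc k) (pred n)
  ≡⟨ cong (λ w → P K (n ∸ Δ K) + K * P (suc k) w) (cong pred (+-suc m (suc k))) ⟩
    P K (n ∸ Δ K) + K * P₀ (suc k) m ∎))
  where
  open ≤-Reasoning
  K : ℕ
  K = suc (suc k)
  n : ℕ
  n = m + K

part-i-bound : ∀ j k m → let K = suc (suc k) in
  suc j * (2 * (K * K * suc k)) ≤ m → suc j * (p (m + K) K ∸ q (m + K) K) ≤ p (m + K) K
part-i-bound j k m cond rewrite p≡P (m + suc (suc k)) (suc (suc k)) | q≡P (m + suc (suc k)) (suc (suc k)) =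
  cancel-*ʳ _ _ C 1≤C (begin
    suc j * d * C
  ≡⟨ swap-last (suc j) d C ⟩
    suc j * C * d
  ≤⟨ *-monoˡ-≤ d cond ⟩
    m * d
  ≤⟨ *-monoʳ-≤ m (deficit≤ k m) ⟩
    m * (K * P₀ (suc k) m)
  ≡⟨ swap m K (P₀ (suc k) m) ⟩
    K * (m * P₀ (suc k) m)
  ≤⟨ *-monoʳ-≤ K (P₀-ratio k m ratio-cond) ⟩
    K * (2 * (K * suc k) * P₀ K m)
  ≡⟨ collect K (suc k) (P₀ K m) ⟩
    P₀ K m * C ∎)
  where
  open ≤-Reasoning
  K : ℕ
  K = suc (suc k)
  C : ℕ
  C = 2 * (K * K * suc k)
  1≤C : 1 ≤ C
  1≤C = *-mono-≤ (s≤s (z≤n {1})) (*-mono-≤ (*-mono-≤ (s≤s (z≤n {suc k})) (s≤s (z≤n {suc k}))) (s≤s (z≤n {k})))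
  d : ℕ
  d = P K (m + K) ∸ P K (m + K ∸ Δ K)
  -- the hypothesis of P₀-ratio is much weaker than ours
  ratio-cond : 2 * (k * Δ (suc k)) ≤ suc m
  ratio-cond = ≤-trans (*-monoʳ-≤ 2 (*-mono-≤ (≤-trans (n≤1+n k) (n≤1+n (suc k))) (≤-trans (Δ≤square (suc k)) (*-monoˡ-≤ (suc k) (n≤1+n (suc k))))))
               (≤-trans (≤-reflexive (cong (2 *_) (sym (*-assoc K K (suc k))))) (≤-trans (m≤n*m C (suc j)) (≤-trans cond (n≤1+n m))))
  swap-last : ∀ a b c → a * b * c ≡ a * c * b
  swap-last = solve-∀
  swap : ∀ m K x → m * (K * x) ≡ K * (m * x)
  swap = solve-∀
  collect : ∀ K k x → K * (2 * (K * k) * x) ≡ x * (2 * (K * K * k))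
  collect = solve-∀

part-i-pointwise : ∀ j n K → 1 ≤ K → K ≤ n → (2 * suc j + 1) * K ^ 3 ≤ n → suc j * (p n K ∸ q n K) ≤ p n K
part-i-pointwise j n (suc zero) _ _ _ rewrite p≡P n 1 | q≡P n 1 | n∸n≡0 (P 1 n) | *-zeroʳ (suc j) = z≤n
part-i-pointwise j n (suc (suc k)) _ K≤n cond =
  subst (λ w → suc j * (p w K ∸ q w K) ≤ p w K) (m∸n+n≡m K≤n) (part-i-bound j k (n ∸ K) cond′)
  where
  K : ℕ
  K = suc (suc k)
  X : ℕ
  X = suc j * (2 * (K * K * suc k))
  X≤ : X ≤ 2 * suc j * K ^ 3
  X≤ = subst (X ≤_) (cube (suc j) K) (*-monoʳ-≤ (suc j) (*-monoʳ-≤ 2 (*-monoʳ-≤ (K * K) (n≤1+n (suc k)))))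
    where
    cube : ∀ s K → s * (2 * (K * K * K)) ≡ 2 * s * (K * (K * (K * 1)))
    cube = solve-∀
  K≤K³ : K ≤ K ^ 3
  K≤K³ = subst (K ≤_) (cube K) (m≤m*n K (K * K))
    where
    cube : ∀ K → K * (K * K) ≡ K * (K * (K * 1))
    cube = solve-∀
  cond′ : X ≤ n ∸ K
  cond′ = +-cancelʳ-≤ K X (n ∸ K) (≤-trans (+-mono-≤ X≤ K≤K³)
            (≤-trans (≤-reflexive (collect (suc j) (K ^ 3))) (≤-trans cond (≤-reflexive (sym (m∸n+n≡m K≤n))))))
    where
    collect : ∀ s c → 2 * s * c + c ≡ (2 * s + 1) * c
    collect = solve-∀

-- Vectors of naturals indexed by ℕ (entries beyond the length read as 0), point updates,
-- and the translation of the boolean tests of Defs into statements about entries.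

at : ∀ {k} → Vec ℕ k → ℕ → ℕ
at []      _       = 0
at (x ∷ v) zero    = x
at (x ∷ v) (suc i) = at v i

upd : ∀ {k} → Vec ℕ k → ℕ → (ℕ → ℕ) → Vec ℕ k
upd []      _       _ = []
upd (x ∷ v) zero    f = f x ∷ v
upd (x ∷ v) (suc i) f = x ∷ upd v i f

at-upd-same : ∀ {k} (v : Vec ℕ k) i f → i < k → at (upd v i f) i ≡ f (at v i)
at-upd-same (x ∷ v) zero    f _        = refl
at-upd-same (x ∷ v) (suc i) f (s≤s lt) = at-upd-same v i f lt

at-upd-other : ∀ {k} (v : Vec ℕ k) i f j → j ≢ i → at (upd v i f) j ≡ at v j
at-upd-other []      i       f j       ne = refl
at-upd-other (x ∷ v) zero    f zero    ne = ⊥-elim (ne refl)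
at-upd-other (x ∷ v) zero    f (suc j) ne = refl
at-upd-other (x ∷ v) (suc i) f zero    ne = refl
at-upd-other (x ∷ v) (suc i) f (suc j) ne = at-upd-other v i f j (λ e → ne (cong suc e))

sum-upd : ∀ {k} (v : Vec ℕ k) i f → i < k → vsum (upd v i f) + at v i ≡ vsum v + f (at v i)
sum-upd (x ∷ v) zero    f _        = swap (f x) (vsum v) x
  where
  swap : ∀ a b c → a + b + c ≡ c + b + a
  swap = solve-∀
sum-upd (x ∷ v) (suc i) f (s≤s lt) =
  trans (+-assoc x (vsum (upd v i f)) (at v i)) (trans (cong (x +_) (sum-upd v i f lt)) (sym (+-assoc x (vsum v) _)))

vec-ext : ∀ {k} (v w : Vec ℕ k) → (∀ j → j < k → at v j ≡ at w j) → v ≡ w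
vec-ext []      []      e = refl
vec-ext (x ∷ v) (y ∷ w) e = cong₂ _∷_ (e 0 (s≤s z≤n)) (vec-ext v w (λ j lt → e (suc j) (s≤s lt)))

at≤sum : ∀ {k} (v : Vec ℕ k) j → at v j ≤ vsum v
at≤sum []      j       = z≤n
at≤sum (x ∷ v) zero    = m≤m+n x (vsum v)
at≤sum (x ∷ v) (suc j) = ≤-trans (at≤sum v j) (m≤n+m (vsum v) x)

vsum≡Sum : ∀ {k} (v : Vec ℕ k) → vsum v ≡ Sum k (at v)
vsum≡Sum []              = refl
vsum≡Sum {suc k} (x ∷ v) = trans (cong (x +_) (vsum≡Sum v)) (sym (Sum-shift k (at (x ∷ v))))

Positive NonIncreasing StrictlyDecreasing : ∀ {k} → Vec ℕ k → Set
Positive           {k} v = ∀ i → i < k → 1 ≤ at v i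
NonIncreasing      {k} v = ∀ i → suc i < k → at v (suc i) ≤ at v i
StrictlyDecreasing {k} v = ∀ i → suc i < k → at v (suc i) < at v i

allPos⇒ : ∀ {k} (v : Vec ℕ k) → allPos v ≡ true → Positive v
allPos⇒ (x ∷ v) e zero    _        = ≤ᵇ-sound (proj₁ (∧-true⁻ e))
allPos⇒ (x ∷ v) e (suc i) (s≤s lt) = allPos⇒ v (proj₂ (∧-true⁻ {1 ≤ᵇ x} e)) i lt

allPos⇐ : ∀ {k} (v : Vec ℕ k) → Positive v → allPos v ≡ true
allPos⇐ []      h = refl
allPos⇐ (x ∷ v) h = ∧-true⁺ (≤ᵇ-true (h 0 (s≤s z≤n))) (allPos⇐ v (λ i lt → h (suc i) (s≤s lt)))

nonIncr⇐ : ∀ {k} (v : Vec ℕ k) → NonIncreasing v → nonIncr v ≡ true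
nonIncr⇐ []          h = refl
nonIncr⇐ (x ∷ [])    h = refl
nonIncr⇐ (x ∷ y ∷ v) h = ∧-true⁺ (≤ᵇ-true (h 0 (s≤s (s≤s z≤n)))) (nonIncr⇐ (y ∷ v) (λ i lt → h (suc i) (s≤s lt)))

strictDecr⇒ : ∀ {k} (v : Vec ℕ k) → strictDecr v ≡ true → StrictlyDecreasing v
strictDecr⇒ (x ∷ [])    e zero    (s≤s ())
strictDecr⇒ (x ∷ y ∷ v) e zero    _        = ≤ᵇ-sound (proj₁ (∧-true⁻ e))
strictDecr⇒ (x ∷ y ∷ v) e (suc i) (s≤s lt) = strictDecr⇒ (y ∷ v) (proj₂ (∧-true⁻ {y <ᵇ x} e)) i lt

nonIncreasing-mono : ∀ {k} (v : Vec ℕ k) → NonIncreasing v → ∀ i d → i + d < k → at v (i + d) ≤ at v i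
nonIncreasing-mono v h i zero    lt = ≤-reflexive (cong (at v) (+-identityʳ i))
nonIncreasing-mono v h i (suc d) lt rewrite +-suc i d =
  ≤-trans (h (i + d) lt) (nonIncreasing-mono v h i d (<-trans (n<1+n (i + d)) lt))

allVecs-complete : ∀ k b (v : Vec ℕ k) → (∀ j → j < k → at v j ≤ b) → v ∈ allVecs k b
allVecs-complete zero    b []      h = here refl
allVecs-complete (suc k) b (x ∷ v) h =
  ∈-concat⁺′ (∈-map⁺ (x ∷_) (allVecs-complete k b v (λ j lt → h (suc j) (s≤s lt))))
             (∈-map⁺ (λ y → map (y ∷_) (allVecs k b)) (∈-upTo⁺ (s≤s (h 0 (s≤s z≤n)))))

allVecs-unique : ∀ k b → Unique (allVecs k b)
allVecs-unique zero    b = [] ∷ []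
allVecs-unique (suc k) b = prefixes (upTo (suc b)) (Unique.upTo⁺ (suc b))
  where
  L : List (Vec ℕ k)
  L = allVecs k b
  block : ℕ → List (Vec ℕ (suc k))
  block y = map (y ∷_) L
  head-block : ∀ {x v} → v ∈ block x → head v ≡ x
  head-block m with ∈-map⁻ _ m
  ... | _ , _ , refl = refl
  head-blocks : ∀ {v} xs → v ∈ concatMap block xs → head v ∈ xs
  head-blocks {v} xs m with ∈-concat⁻′ (map block xs) m
  ... | ys , v∈ys , ys∈ with ∈-map⁻ block ys∈
  ...   | y , y∈ , refl = subst (_∈ xs) (sym (head-block v∈ys)) y∈
  ∷-injectiveʳ : ∀ {a b : ℕ} {u w : Vec ℕ k} → a ∷ u ≡ b ∷ w → u ≡ w
  ∷-injectiveʳ refl = refl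
  prefixes : ∀ xs → Unique xs → Unique (concatMap block xs)
  prefixes []       _          = []
  prefixes (x ∷ xs) (x∉ ∷ uxs) =
    Unique.++⁺ (Unique.map⁺ ∷-injectiveʳ (allVecs-unique k b)) (prefixes xs uxs)
               (λ (m₁ , m₂) → All.lookup x∉ (head-blocks xs m₂) (sym (head-block m₁)))

module _ {A B : Set} where

  remove : ∀ {z : B} (ys : List B) → z ∈ ys → List B
  remove (y ∷ ys) (here _)  = ys
  remove (y ∷ ys) (there p) = y ∷ remove ys p

  length-remove : ∀ {z : B} (ys : List B) (p : z ∈ ys) → suc (length (remove ys p)) ≡ length ys
  length-remove (y ∷ ys) (here _)  = refl
  length-remove (y ∷ ys) (there p) = cong suc (length-remove ys p)

  ∈-remove : ∀ {z w : B} (ys : List B) (p : z ∈ ys) → w ∈ ys → w ≢ z → w ∈ remove ys p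
  ∈-remove (y ∷ ys) (here refl) (here refl) ne = ⊥-elim (ne refl)
  ∈-remove (y ∷ ys) (here refl) (there q)   ne = q
  ∈-remove (y ∷ ys) (there p)   (here refl) ne = here refl
  ∈-remove (y ∷ ys) (there p)   (there q)   ne = there (∈-remove ys p q ne)

  length-≤-injection : ∀ (f : A → B) xs ys → Unique xs → (∀ {x} → x ∈ xs → f x ∈ ys) →
    (∀ {x y} → x ∈ xs → y ∈ xs → f x ≡ f y → x ≡ y) → length xs ≤ length ys
  length-≤-injection f []       ys _          _    _   = z≤n
  length-≤-injection f (x ∷ xs) ys (x∉ ∷ uxs) into inj =
    ≤-trans (s≤s (length-≤-injection f xs (remove ys fx∈) uxs into′ inj′)) (≤-reflexive (length-remove ys fx∈))
    where
    fx∈ : f x ∈ ys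
    fx∈ = into (here refl)
    into′ : ∀ {y} → y ∈ xs → f y ∈ remove ys fx∈
    into′ y∈ = ∈-remove ys fx∈ (into (there y∈)) (λ e → All.lookup x∉ y∈ (sym (inj (there y∈) (here refl) e)))
    inj′ : ∀ {a b} → a ∈ xs → b ∈ xs → f a ≡ f b → a ≡ b
    inj′ a∈ b∈ = inj (there a∈) (there b∈)

-- The merge operation of part (ii): lower entry i to the value of entry i+1 and add the
-- gap to entry 0.  The sum is unchanged, and on a strictly decreasing vector the result is
-- non-increasing with exactly one tie, at i.

gap : ∀ {k} → Vec ℕ k → ℕ → ℕ
gap v i = at v i ∸ at v (suc i)

merge : ∀ {k} → Vec ℕ k → ℕ → Vec ℕ k
merge v i = upd (upd v i (λ _ → at v (suc i))) 0 (λ x → x + gap v i)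

module Merge {k} (v : Vec ℕ k) (i : ℕ) (1≤i : 1 ≤ i) (i+1<k : suc i < k) where
  w : Vec ℕ k
  w = upd v i (λ _ → at v (suc i))
  μ : Vec ℕ k
  μ = merge v i
  i<k : i < k
  i<k = <-trans (n<1+n i) i+1<k
  i≢0 : i ≢ 0
  i≢0 e = <⇒≢ 1≤i (sym e)

  merge-0 : at μ 0 ≡ at v 0 + gap v i
  merge-0 = trans (at-upd-same w 0 _ (≤-trans (s≤s z≤n) i<k)) (cong (_+ gap v i) (at-upd-other v i _ 0 (λ e → i≢0 (sym e))))

  merge-i : at μ i ≡ at v (suc i)
  merge-i = trans (at-upd-other w 0 _ i i≢0) (at-upd-same v i _ i<k)

  merge-other : ∀ j → j ≢ 0 → j ≢ i → at μ j ≡ at v j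
  merge-other j j≢0 j≢i = trans (at-upd-other w 0 _ j j≢0) (at-upd-other v i _ j j≢i)

  merge-i+1 : at μ (suc i) ≡ at v (suc i)
  merge-i+1 = merge-other (suc i) (λ ()) (λ e → <-irrefl (sym e) (n<1+n i))

  merge-sum : at v (suc i) ≤ at v i → vsum μ ≡ vsum v
  merge-sum le = +-cancelʳ-≡ (at v (suc i)) (vsum μ) (vsum v) (begin
      vsum μ + at v (suc i)               ≡⟨ cong (_+ at v (suc i)) μ≡w+gap ⟩
      vsum w + gap v i + at v (suc i)     ≡⟨ +-assoc (vsum w) (gap v i) (at v (suc i)) ⟩
      vsum w + (gap v i + at v (suc i))   ≡⟨ cong (vsum w +_) (m∸n+n≡m le) ⟩
      vsum w + at v i                     ≡⟨ sum-upd v i _ i<k ⟩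
      vsum v + at v (suc i)               ∎)
    where
    open ≡-Reasoning
    μ≡w+gap : vsum μ ≡ vsum w + gap v i
    μ≡w+gap = +-cancelʳ-≡ (at w 0) _ _ (trans (sum-upd w 0 _ (≤-trans (s≤s z≤n) i<k)) (swap (vsum w) (at w 0) (gap v i)))
      where
      swap : ∀ a b c → a + (b + c) ≡ a + c + b
      swap = solve-∀

  module Distinct (pos : Positive v) (dec : StrictlyDecreasing v) where
    merge-≥ : ∀ j → j ≢ i → at v j ≤ at μ j
    merge-≥ zero    _   = subst (at v 0 ≤_) (sym merge-0) (m≤m+n _ _)
    merge-≥ (suc j) j≢i = ≤-reflexive (sym (merge-other (suc j) (λ ()) j≢i))

    merge-≤ : ∀ j → 1 ≤ j → at μ j ≤ at v j
    merge-≤ j 1≤j with j ≟ i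
    ... | yes refl = subst (_≤ at v i) (sym merge-i) (<⇒≤ (dec i i+1<k))
    ... | no  j≢i  = ≤-reflexive (merge-other j (λ e → <⇒≢ 1≤j (sym e)) j≢i)

    merge-nonIncreasing : NonIncreasing μ
    merge-nonIncreasing j lt with j ≟ i
    ... | yes refl = ≤-reflexive (trans merge-i+1 (sym merge-i))
    ... | no  j≢i  = ≤-trans (merge-≤ (suc j) (s≤s z≤n)) (≤-trans (<⇒≤ (dec j lt)) (merge-≥ j j≢i))

    merge-positive : Positive μ
    merge-positive j lt with j ≟ i
    ... | yes refl = subst (1 ≤_) (sym merge-i) (pos (suc i) i+1<k)
    ... | no  j≢i  = ≤-trans (pos j lt) (merge-≥ j j≢i)

    gap-positive : 1 ≤ gap v i
    gap-positive = m<n⇒0<n∸m (dec i i+1<k)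

    tie : at μ i ≡ at μ (suc i)
    tie = trans merge-i (sym merge-i+1)

    tie-unique : ∀ i′ → suc i′ < k → at μ i′ ≡ at μ (suc i′) → i′ ≡ i
    tie-unique i′ lt e with i′ ≟ i
    ... | yes i′≡i = i′≡i
    ... | no  i′≢i = ⊥-elim (<-irrefl (sym e) (≤-<-trans (merge-≤ (suc i′) (s≤s z≤n)) (<-≤-trans (dec i′ lt) (merge-≥ i′ i′≢i))))

merge-injective : ∀ {k} (v v′ : Vec ℕ k) i (1≤i : 1 ≤ i) (lt : suc i < k) →
  at v (suc i) ≤ at v i → at v′ (suc i) ≤ at v′ i → merge v i ≡ merge v′ i → gap v i ≡ gap v′ i → v ≡ v′
merge-injective {k} v v′ i 1≤i lt le le′ eμ eg = vec-ext v v′ pointwise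
  where
  module A = Merge v  i 1≤i lt
  module B = Merge v′ i 1≤i lt
  same : ∀ j → at (merge v i) j ≡ at (merge v′ i) j
  same j = cong (λ z → at z j) eμ
  pointwise : ∀ j → j < k → at v j ≡ at v′ j
  pointwise j _ with j ≟ 0 | j ≟ i
  ... | yes refl | _ = +-cancelʳ-≡ (gap v i) (at v 0) (at v′ 0)
                         (trans (sym A.merge-0) (trans (same 0) (trans B.merge-0 (cong (at v′ 0 +_) (sym eg)))))
  ... | no _ | yes refl = begin
      at v i                      ≡⟨ sym (m∸n+n≡m le) ⟩
      gap v i + at v (suc i)      ≡⟨ cong₂ _+_ eg (trans (sym A.merge-i+1) (trans (same (suc i)) B.merge-i+1)) ⟩
      gap v′ i + at v′ (suc i)    ≡⟨ m∸n+n≡m le′ ⟩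
      at v′ i                     ∎
    where open ≡-Reasoning
  ... | no j≢0 | no j≢i = trans (sym (A.merge-other j j≢0 j≢i)) (trans (same j) (B.merge-other j j≢0 j≢i))

-- Merging at a small site sends
--   (distinct partition v, small site t)  ↦  (partition, gap ∈ {1, …, B})
-- injectively, so  q · (least number of small sites) ≤ p · B.
module DoubleCount (n k L B : ℕ) (1≤L : 1 ≤ L) (2L+2≤k : L + L + 2 ≤ k) where

  site : ℕ → ℕ
  site t = suc (L + t)

  site+1<k : ∀ t → t < L → suc (site t) < k
  site+1<k t t<L = ≤-trans (s≤s (s≤s (subst (_≤ L + L) (+-suc L t) (+-monoʳ-≤ L t<L)))) (≤-trans (≤-reflexive (two L)) 2L+2≤k)
    where
    two : ∀ L → suc (suc (L + L)) ≡ L + L + 2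
    two = solve-∀

  small : Vec ℕ k → ℕ → Bool
  small v t = gap v (site t) ≤ᵇ B

  U : List (Vec ℕ k)
  U = allVecs k n

  inDom inCod : Vec ℕ k × ℕ → Bool
  inDom (v , t) = isDistinctPartition n k v ∧ small v t
  inCod (μ , s) = isPartition n k μ ∧ (1 ≤ᵇ s)

  Dom Cod : List (Vec ℕ k × ℕ)
  Dom = filterᵇ inDom (cartesianProduct U (upTo L))
  Cod = filterᵇ inCod (cartesianProduct U (upTo (suc B)))

  F : Vec ℕ k × ℕ → Vec ℕ k × ℕ
  F (v , t) = merge v (site t) , gap v (site t)

  record Distinct (v : Vec ℕ k) : Set where
    field
      positive   : Positive v
      decreasing : StrictlyDecreasing v
      sums       : vsum v ≡ n

  distinct : ∀ v → isDistinctPartition n k v ≡ true → Distinct v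
  distinct v e = record { positive = allPos⇒ v (proj₁ e₁) ; decreasing = strictDecr⇒ v (proj₁ e₂) ; sums = ≡ᵇ-sound (proj₂ e₂) }
    where
    e₁ : (allPos v ≡ true) × (strictDecr v ∧ (vsum v ≡ᵇ n) ≡ true)
    e₁ = ∧-true⁻ {allPos v} e
    e₂ : (strictDecr v ≡ true) × ((vsum v ≡ᵇ n) ≡ true)
    e₂ = ∧-true⁻ {strictDecr v} (proj₂ e₁)

  dom-site : ∀ {v t} → (v , t) ∈ Dom → t < L
  dom-site x∈ = ∈-upTo⁻ (proj₂ (∈-cartesianProduct⁻ U (upTo L) (proj₁ (∈-filter⁻ (T? ∘ inDom) {xs = cartesianProduct U (upTo L)} x∈))))

  dom-test : ∀ {v t} → (v , t) ∈ Dom → (isDistinctPartition n k v ≡ true) × (small v t ≡ true)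
  dom-test x∈ = ∧-true⁻ (T⇒≡true (proj₂ (∈-filter⁻ (T? ∘ inDom) {xs = cartesianProduct U (upTo L)} x∈)))

  F-into : ∀ {x} → x ∈ Dom → F x ∈ Cod
  F-into {v , t} x∈ = ∈-filter⁺ (T? ∘ inCod) (∈-cartesianProduct⁺ μ∈U gap∈) (≡true⇒T μ-partition)
    where
    t<L : t < L
    t<L = dom-site x∈
    open Distinct (distinct v (proj₁ (dom-test x∈)))
    open Merge v (site t) (s≤s z≤n) (site+1<k t t<L)
    open Merge.Distinct v (site t) (s≤s z≤n) (site+1<k t t<L) positive decreasing
    μ-sum : vsum μ ≡ n
    μ-sum = trans (merge-sum (<⇒≤ (decreasing (site t) (site+1<k t t<L)))) sums
    μ∈U : μ ∈ U
    μ∈U = allVecs-complete k n μ (λ j _ → subst (at μ j ≤_) μ-sum (at≤sum μ j))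
    gap∈ : gap v (site t) ∈ upTo (suc B)
    gap∈ = ∈-upTo⁺ (s≤s (≤ᵇ-sound (proj₂ (dom-test x∈))))
    μ-partition : inCod (μ , gap v (site t)) ≡ true
    μ-partition = ∧-true⁺ (∧-true⁺ (allPos⇐ μ merge-positive) (∧-true⁺ (nonIncr⇐ μ merge-nonIncreasing) (≡ᵇ-true μ-sum)))
                          (≤ᵇ-true gap-positive)

  -- the site is read off as the unique tie, then v by merge-injective
  F-injective : ∀ {x y} → x ∈ Dom → y ∈ Dom → F x ≡ F y → x ≡ y
  F-injective {v , t} {v′ , t′} x∈ y∈ e = cong₂ _,_ v≡v′ (sym t′≡t)
    where
    i : ℕ
    i  = site t
    i′ : ℕ
    i′ = site t′
    d : Distinct v
    d  = distinct v  (proj₁ (dom-test x∈))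
    d′ : Distinct v′
    d′ = distinct v′ (proj₁ (dom-test y∈))
    lt : suc i < k
    lt  = site+1<k t  (dom-site x∈)
    lt′ : suc i′ < k
    lt′ = site+1<k t′ (dom-site y∈)
    module X = Merge.Distinct v  i  (s≤s z≤n) lt  (Distinct.positive d)  (Distinct.decreasing d)
    module Y = Merge.Distinct v′ i′ (s≤s z≤n) lt′ (Distinct.positive d′) (Distinct.decreasing d′)
    eμ : merge v i ≡ merge v′ i′
    eμ = cong proj₁ e
    i′≡i : i′ ≡ i
    i′≡i = X.tie-unique i′ lt′ (trans (cong (λ z → at z i′) eμ) (trans Y.tie (cong (λ z → at z (suc i′)) (sym eμ))))
    t′≡t : t′ ≡ t
    t′≡t = +-cancelˡ-≡ L t′ t (suc-injective i′≡i)
    v≡v′ : v ≡ v′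
    v≡v′ = merge-injective v v′ i (s≤s z≤n) lt (<⇒≤ (Distinct.decreasing d i lt))
             (<⇒≤ (Distinct.decreasing d′ i (subst (λ z → suc z < k) i′≡i lt′)))
             (subst (λ z → merge v i ≡ merge v′ z) i′≡i eμ) (subst (λ z → gap v i ≡ gap v′ z) i′≡i (cong proj₂ e))

  Dom≤Cod : length Dom ≤ length Cod
  Dom≤Cod = length-≤-injection F Dom Cod
              (Unique.filter⁺ (T? ∘ inDom) (Unique.cartesianProduct⁺ (allVecs-unique k n) (Unique.upTo⁺ L)))
              F-into F-injective

  q·G≤p·B : ∀ G → (∀ v → isDistinctPartition n k v ≡ true → G ≤ count (small v) (upTo L)) → q n k * G ≤ p n k * B
  q·G≤p·B G enough = begin
      q n k * G
    ≡⟨ cong (_* G) (length-filterᵇ _ U) ⟩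
      count (isDistinctPartition n k) U * G
    ≤⟨ count-product-≥ (isDistinctPartition n k) small G U (upTo L) enough ⟩
      count inDom (cartesianProduct U (upTo L))
    ≡⟨ sym (length-filterᵇ inDom (cartesianProduct U (upTo L))) ⟩
      length Dom
    ≤⟨ Dom≤Cod ⟩
      length Cod
    ≡⟨ length-filterᵇ inCod (cartesianProduct U (upTo (suc B))) ⟩
      count inCod (cartesianProduct U (upTo (suc B)))
    ≡⟨ count-product (isPartition n k) (1 ≤ᵇ_) U (upTo (suc B)) ⟩
      count (isPartition n k) U * count (1 ≤ᵇ_) (upTo (suc B))
    ≡⟨ cong₂ _*_ (sym (length-filterᵇ _ U)) gap-values ⟩
      p n k * B ∎
    where
    open ≤-Reasoning
    gap-values : count (1 ≤ᵇ_) (upTo (suc B)) ≡ B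
    gap-values = trans (count-applyUpTo (1 ≤ᵇ_) suc B) (trans (Sum-const B 1) (*-identityʳ B))

  -- A distinct partition has few sites with a large gap: the gaps telescope to at most
  -- v_{L+1} ≤ v_L, while the L+1 largest parts are all ≥ v_L, so (L+1)·v_L ≤ n.
  module Sites (v : Vec ℕ k) (d : Distinct v) where
    open Distinct d

    nsmall nlarge : ℕ
    nsmall = Sum L (λ t → ι (small v t))
    nlarge = Sum L (λ t → ι (not (small v t)))

    small+large : nsmall + nlarge ≡ L
    small+large = trans (sym (Sum-+ L _ _)) (trans (Sum-cong L _ (λ _ → 1) (λ t _ → one (small v t))) (trans (Sum-const L 1) (*-identityʳ L)))
      where
      one : ∀ b → ι b + ι (not b) ≡ 1
      one true  = refl
      one false = refl

    W : ℕ → ℕ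
    W t = at v (site t)

    W-next : ∀ t → W (suc t) ≡ at v (suc (site t))
    W-next t = cong (λ z → at v (suc z)) (+-suc L t)

    W-decreasing : ∀ t → t < L → W (suc t) ≤ W t
    W-decreasing t t<L = subst (_≤ W t) (sym (W-next t)) (<⇒≤ (decreasing (site t) (site+1<k t t<L)))

    large-gap : ∀ t → t < L → suc B * ι (not (small v t)) ≤ W t ∸ W (suc t)
    large-gap t t<L with small v t in e
    ... | true  = subst (_≤ W t ∸ W (suc t)) (sym (*-zeroʳ (suc B))) z≤n
    ... | false = subst₂ _≤_ (sym (*-identityʳ (suc B))) (cong (W t ∸_) (sym (W-next t))) (≤ᵇ-false⇒> e)

    L+1<k : suc L < k
    L+1<k = <⇒≤ (subst (λ z → suc (suc (suc z)) ≤ k) (+-identityʳ L) (site+1<k 0 1≤L))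

    large≤v_L : suc B * nlarge ≤ at v L
    large≤v_L = begin
        suc B * nlarge
      ≡⟨ Sum-*ˡ (suc B) L _ ⟩
        Sum L (λ t → suc B * ι (not (small v t)))
      ≤⟨ Sum-mono L _ _ large-gap ⟩
        Sum L (λ t → W t ∸ W (suc t))
      ≤⟨ m≤m+n _ (W L) ⟩
        Sum L (λ t → W t ∸ W (suc t)) + W L
      ≡⟨ Sum-telescope W L W-decreasing ⟩
        at v (suc (L + 0))
      ≤⟨ <⇒≤ (subst (λ z → at v (suc z) < at v L) (sym (+-identityʳ L)) (decreasing L L+1<k)) ⟩
        at v L ∎
      where open ≤-Reasoning

    L+1·v_L≤n : suc L * at v L ≤ n
    L+1·v_L≤n = begin
        suc L * at v L
      ≤⟨ Sum-≥ (suc L) (at v) (at v L) below ⟩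
        Sum (suc L) (at v)
      ≤⟨ m≤m+n _ _ ⟩
        Sum (suc L) (at v) + Sum (k ∸ suc L) (λ y → at v (suc L + y))
      ≡⟨ sym (Sum-split (suc L) (k ∸ suc L) (at v)) ⟩
        Sum (suc L + (k ∸ suc L)) (at v)
      ≡⟨ cong (λ z → Sum z (at v)) (m+[n∸m]≡n (<⇒≤ L+1<k)) ⟩
        Sum k (at v)
      ≡⟨ trans (sym (vsum≡Sum v)) sums ⟩
        n ∎
      where
      open ≤-Reasoning
      below : ∀ x → x < suc L → at v L ≤ at v x
      below x x<L+1 = subst (λ z → at v z ≤ at v x) (m+[n∸m]≡n (≤-pred x<L+1))
        (nonIncreasing-mono v (λ j lt → <⇒≤ (decreasing j lt)) x (L ∸ x)
          (subst (_< k) (sym (m+[n∸m]≡n (≤-pred x<L+1))) (<-trans (n<1+n L) L+1<k)))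

    large-bound : suc L * suc B * nlarge ≤ n
    large-bound = begin
        suc L * suc B * nlarge     ≡⟨ *-assoc (suc L) (suc B) nlarge ⟩
        suc L * (suc B * nlarge)   ≤⟨ *-monoʳ-≤ (suc L) large≤v_L ⟩
        suc L * at v L             ≤⟨ L+1·v_L≤n ⟩
        n                          ∎
      where open ≤-Reasoning

  -- with 2n ≤ (L+1)(B+1)L at most half the sites are large, so at least (j+1)B are small
  many-small : ∀ j → 2 * n ≤ suc L * suc B * L → 2 * (suc j * B) ≤ L →
               ∀ v → isDistinctPartition n k v ≡ true → suc j * B ≤ count (small v) (upTo L)
  many-small j 2n≤ 2jT≤L v e = subst (suc j * B ≤_) (sym (count-applyUpTo (small v) id L)) (*-cancelˡ-≤ 2 (≤-trans 2jT≤L L≤2·small))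
    where
    open Sites v (distinct v e)
    X : ℕ
    X = suc L * suc B
    2·large≤L : 2 * nlarge ≤ L
    2·large≤L = cancel-*ʳ _ _ X (s≤s z≤n) (begin
        2 * nlarge * X       ≡⟨ swap nlarge X ⟩
        2 * (X * nlarge)     ≤⟨ *-monoʳ-≤ 2 large-bound ⟩
        2 * n                ≤⟨ 2n≤ ⟩
        X * L                ≡⟨ *-comm X L ⟩
        L * X                ∎)
      where
      open ≤-Reasoning
      swap : ∀ b x → 2 * b * x ≡ 2 * (x * b)
      swap = solve-∀
    L≤2·small : L ≤ 2 * nsmall
    L≤2·small = +-cancelʳ-≤ (2 * nlarge) L (2 * nsmall)
                  (≤-trans (+-monoʳ-≤ L 2·large≤L) (≤-reflexive (trans (twice L) (trans (cong (2 *_) (sym small+large)) (*-distribˡ-+ 2 nsmall nlarge)))))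
      where
      twice : ∀ L → L + L ≡ 2 * L
      twice = solve-∀

halves : ∀ k → Σ ℕ λ h → (h + h ≤ k) × (k ≤ suc (h + h))
halves zero          = 0 , z≤n , z≤n
halves (suc zero)    = 0 , z≤n , s≤s z≤n
halves (suc (suc k)) with halves k
... | h , lo , hi = suc h , subst (_≤ suc (suc k)) (cong suc (sym (+-suc h h))) (s≤s (s≤s lo))
                          , subst (suc (suc k) ≤_) (cong (suc ∘ suc) (sym (+-suc h h))) (s≤s (s≤s hi))

k-large : ∀ s n k → k ≤ n → n * (512 * (s * s)) < k ^ 3 → 8 * s < k
k-large s n k k≤n cond with 8 * s <? k
... | yes 8s<k = 8s<k
... | no  8s≮k = ⊥-elim (<⇒≱ square (≤-trans (*-mono-≤ k≤8s k≤8s) (≤-trans (≤-reflexive (sq s)) (*-monoˡ-≤ (s * s) (m≤m+n 64 448)))))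
  where
  k≤8s : k ≤ 8 * s
  k≤8s = ≮⇒≥ 8s≮k
  cube : ∀ k → k ^ 3 ≡ k * (k * k)
  cube k = cong (λ z → k * (k * z)) (*-identityʳ k)
  sq : ∀ s → 8 * s * (8 * s) ≡ 64 * (s * s)
  sq = solve-∀
  square : 512 * (s * s) < k * k
  square = *-cancelˡ-< k _ _ (≤-<-trans (*-monoˡ-≤ (512 * (s * s)) k≤n) (subst (n * (512 * (s * s)) <_) (cube k) cond))

-- L = ⌊k/2⌋ - 1 satisfies 3 ≤ L and 2L + 2 ≤ k ≤ 4L once k > 8
half-parameter : ∀ k → 8 < k → Σ ℕ λ L → (3 ≤ L) × (L + L + 2 ≤ k) × (k ≤ 4 * L)
half-parameter k 8<k with halves k
... | zero                      , _  , k≤1 = ⊥-elim (<⇒≱ 8<k (≤-trans k≤1 (s≤s z≤n)))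
... | suc zero                  , _  , k≤3 = ⊥-elim (<⇒≱ 8<k (≤-trans k≤3 (s≤s (s≤s (s≤s z≤n)))))
... | suc (suc zero)            , _  , k≤5 = ⊥-elim (<⇒≱ 8<k (≤-trans k≤5 (s≤s (s≤s (s≤s (s≤s (s≤s z≤n)))))))
... | suc (suc (suc zero))      , _  , k≤7 = ⊥-elim (<⇒≱ 8<k (m≤n⇒m≤1+n k≤7))
... | suc (suc (suc (suc L′)))  , lo , hi = L , (s≤s (s≤s (s≤s z≤n))) , subst (_≤ k) (double L) lo , ≤-trans hi (linear L′)
  where
  L : ℕ
  L = suc (suc (suc L′))
  double : ∀ L → suc L + suc L ≡ L + L + 2
  double = solve-∀
  linear : ∀ L′ → suc (suc (3 + L′) + suc (3 + L′)) ≤ 4 * (3 + L′)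
  linear L′ = subst₂ _≤_ (sym (lhs L′)) (sym (rhs L′)) (m≤m+n (9 + 2 * L′) (3 + 2 * L′))
    where
    lhs : ∀ L′ → suc (suc (3 + L′) + suc (3 + L′)) ≡ 9 + 2 * L′
    lhs = solve-∀
    rhs : ∀ L′ → 4 * (3 + L′) ≡ 9 + 2 * L′ + (3 + 2 * L′)
    rhs = solve-∀

quotient-parameter : ∀ L d .{{_ : NonZero d}} → d ≤ L → (1 ≤ L / d) × (L / d * d ≤ L) × (L < suc (L / d) * d)
quotient-parameter L d d≤L = 1≤B , m/n*n≤m L d , subst (_< suc (L / d) * d) (sym L≡) (+-monoˡ-< (L / d * d) (m%n<n L d))
  where
  L≡ : L ≡ L % d + L / d * d
  L≡ = m≡m%n+[m/n]*n L d
  1≤B : 1 ≤ L / d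
  1≤B with L / d | L≡
  ... | zero  | e = ⊥-elim (<⇒≱ (subst (_< d) (sym (trans e (+-identityʳ _))) (m%n<n L d)) d≤L)
  ... | suc _ | _ = s≤s z≤n

cube-shrink : ∀ s n k L → k ≤ 4 * L → n * (512 * (s * s)) < k ^ 3 → 8 * s * s * n < L * L * L
cube-shrink s n k L k≤4L cond =
  *-cancelˡ-< 64 _ _ (≤-trans (s≤s (≤-reflexive (e1 s n))) (≤-trans cond (≤-trans (^-monoˡ-≤ 3 k≤4L) (≤-reflexive (e2 L)))))
  where
  e1 : ∀ s n → 64 * (8 * s * s * n) ≡ n * (512 * (s * s))
  e1 = solve-∀
  e2 : ∀ L → (4 * L) * ((4 * L) * ((4 * L) * 1)) ≡ 64 * (L * L * L)
  e2 = solve-∀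

sites-suffice : ∀ s n L B → 8 * suc s * suc s * n < L * L * L → L < suc B * (2 * suc s) → 2 * n ≤ suc L * suc B * L
sites-suffice s n L B cube L< = *-cancelˡ-≤ d (begin
    d * (2 * n)                ≡⟨ e1 (suc s) n ⟩
    4 * suc s * 1 * n          ≤⟨ *-monoˡ-≤ n (*-monoʳ-≤ (4 * suc s) (s≤s (z≤n {s}))) ⟩
    4 * suc s * suc s * n      ≤⟨ *-monoˡ-≤ n (*-monoˡ-≤ (suc s) (*-monoˡ-≤ (suc s) (m≤m+n 4 4))) ⟩
    8 * suc s * suc s * n      ≤⟨ <⇒≤ cube ⟩
    L * L * L                  ≤⟨ *-monoʳ-≤ (L * L) (<⇒≤ L<) ⟩
    L * L * (suc B * d)        ≤⟨ *-monoˡ-≤ (suc B * d) (*-monoˡ-≤ L (n≤1+n L)) ⟩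
    suc L * L * (suc B * d)    ≡⟨ e2 L B d ⟩
    d * (suc L * suc B * L)    ∎)
  where
  open ≤-Reasoning
  d : ℕ
  d = 2 * suc s
  e1 : ∀ s n → 2 * s * (2 * n) ≡ 4 * s * 1 * n
  e1 = solve-∀
  e2 : ∀ L t d → suc L * L * (suc t * d) ≡ d * (suc L * suc t * L)
  e2 = solve-∀

record SiteParameters (j n k : ℕ) : Set where
  field
    L B            : ℕ
    1≤L            : 1 ≤ L
    2L+2≤k         : L + L + 2 ≤ k
    1≤B            : 1 ≤ B
    2n≤[L+1][B+1]L : 2 * n ≤ suc L * suc B * L
    2[j+1]B≤L      : 2 * (suc j * B) ≤ L

choose-parameters : ∀ j n k → k ≤ n → n * (512 * (suc j * suc j)) < k ^ 3 → SiteParameters j n k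
choose-parameters j n k k≤n cond = record
  { L = L ; B = B ; 1≤L = ≤-trans (s≤s z≤n) 3≤L ; 2L+2≤k = 2L+2≤k ; 1≤B = 1≤B ; 2n≤[L+1][B+1]L = few-large ; 2[j+1]B≤L = room }
  where
  s : ℕ
  s = suc j
  d : ℕ
  d = 2 * s
  8s<k : 8 * s < k
  8s<k = k-large s n k k≤n cond
  halving : Σ ℕ λ L → (3 ≤ L) × (L + L + 2 ≤ k) × (k ≤ 4 * L)
  halving = half-parameter k (≤-<-trans (*-monoʳ-≤ 8 (s≤s (z≤n {j}))) 8s<k)
  L : ℕ
  L = proj₁ halving
  3≤L : 3 ≤ L
  3≤L = proj₁ (proj₂ halving)
  2L+2≤k : L + L + 2 ≤ k
  2L+2≤k = proj₁ (proj₂ (proj₂ halving))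
  k≤4L : k ≤ 4 * L
  k≤4L = proj₂ (proj₂ (proj₂ halving))
  d≤L : d ≤ L
  d≤L = *-cancelˡ-≤ 4 (subst (_≤ 4 * L) (eight s) (≤-trans (<⇒≤ 8s<k) k≤4L))
    where
    eight : ∀ s → 8 * s ≡ 4 * (2 * s)
    eight = solve-∀
  B : ℕ
  B = L / d
  quotient : (1 ≤ B) × (B * d ≤ L) × (L < suc B * d)
  quotient = quotient-parameter L d d≤L
  1≤B : 1 ≤ B
  1≤B = proj₁ quotient
  room : 2 * (s * B) ≤ L
  room = subst (_≤ L) (swap B s) (proj₁ (proj₂ quotient))
    where
    swap : ∀ t s → t * (2 * s) ≡ 2 * (s * t)
    swap = solve-∀
  few-large : 2 * n ≤ suc L * suc B * L
  few-large = sites-suffice j n L B (cube-shrink s n k L k≤4L cond) (proj₂ (proj₂ quotient))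

part-ii-bound : ∀ j n k → k ≤ n → n * (512 * (suc j * suc j)) < k ^ 3 → suc j * q n k ≤ p n k
part-ii-bound j n k k≤n cond = cancel-*ʳ (suc j * q n k) (p n k) B 1≤B
  (subst (_≤ p n k * B) (swap (q n k) (suc j) B) (q·G≤p·B (suc j * B) (many-small j 2n≤[L+1][B+1]L 2[j+1]B≤L)))
  where
  open SiteParameters (choose-parameters j n k k≤n cond)
  open DoubleCount n k L B 1≤L 2L+2≤k
  swap : ∀ q s t → q * (s * t) ≡ s * q * t
  swap = solve-∀

module FractionBounds where
  open import Data.Integer as ℤ using (ℤ; +_)
  import Data.Integer.Properties as ℤP
  open import Data.Integer.Tactic.RingSolver as ℤSolver using ()
  open import Data.Rational using (toℚᵘ; fromℚᵘ)
  import Data.Rational.Properties as ℚP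
  open import Data.Rational.Unnormalised as U using (ℚᵘ; mkℚᵘ; *≡*; *≤*)
  import Data.Rational.Unnormalised.Properties as UP

  ≤invSuc : ∀ a b j → suc j * a ≤ suc b → mkℚᵘ (+ a) b U.≤ mkℚᵘ (+ 1) j
  ≤invSuc a b j le = *≤* (subst₂ ℤ._≤_ (ℤP.pos-* a (suc j)) (ℤP.pos-* 1 (suc b))
                           (ℤ.+≤+ (subst₂ _≤_ (*-comm (suc j) a) (sym (*-identityˡ (suc b))) le)))

  frac-small : ∀ a b j → 1 ≤ b → suc j * a ≤ b → ∣ frac a b ∣ ≤ℚ invSuc j
  frac-small a (suc b) j _ le =
    ℚP.toℚᵘ-cancel-≤ (UP.≤-respˡ-≃ (UP.≃-sym lhs) (UP.≤-respʳ-≃ (UP.≃-sym (ℚP.toℚᵘ-fromℚᵘ (mkℚᵘ (+ 1) j))) (≤invSuc a b j le)))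
    where
    x : ℚᵘ
    x = mkℚᵘ (+ a) b
    lhs : toℚᵘ ∣ fromℚᵘ x ∣ U.≃ x
    lhs = UP.≃-trans (ℚP.toℚᵘ-homo-∣-∣ (fromℚᵘ x)) (UP.∣-∣-cong (ℚP.toℚᵘ-fromℚᵘ x))

  frac-near-one : ∀ a b j → 1 ≤ b → a ≤ b → suc j * (b ∸ a) ≤ b → ∣ frac a b - 1ℚ ∣ ≤ℚ invSuc j
  frac-near-one a (suc b) j _ a≤b le =
    ℚP.toℚᵘ-cancel-≤ (UP.≤-respˡ-≃ (UP.≃-sym lhs) (UP.≤-respʳ-≃ (UP.≃-sym (ℚP.toℚᵘ-fromℚᵘ (mkℚᵘ (+ 1) j))) (≤invSuc (suc b ∸ a) b j le)))
    where
    x : ℚᵘ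
    x = mkℚᵘ (+ a) b
    δ : ℚᵘ
    δ = mkℚᵘ (+ (suc b ∸ a)) b
    x-1 : (x U.- U.1ℚᵘ) U.≃ U.- δ
    x-1 = *≡* (trans (alg (+ a) (+ suc b))
                     (cong₂ ℤ._*_ (cong ℤ.-_ (sym (trans (sym (ℤP.≤-⊖ a≤b)) (sym (ℤP.m-n≡m⊖n (suc b) a)))))
                                  (cong (λ z → + suc z) (sym (*-identityʳ b)))))
      where
      alg : ∀ (A B : ℤ) → (A ℤ.* + 1 ℤ.+ (ℤ.- (+ 1)) ℤ.* B) ℤ.* B ≡ (ℤ.- (B ℤ.- A)) ℤ.* B
      alg = ℤSolver.solve-∀
    lhs : toℚᵘ ∣ fromℚᵘ x - 1ℚ ∣ U.≃ δ
    lhs = UP.≃-trans (ℚP.toℚᵘ-homo-∣-∣ (fromℚᵘ x - 1ℚ))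
            (UP.≃-trans (UP.∣-∣-cong (UP.≃-trans (ℚP.toℚᵘ-homo-+ (fromℚᵘ x) (Data.Rational.-_ 1ℚ))
                                     (UP.≃-trans (UP.+-cong (ℚP.toℚᵘ-fromℚᵘ x) (ℚP.toℚᵘ-homo‿- 1ℚ)) x-1)))
                        (UP.∣-p∣≃∣p∣ δ))

open FractionBounds using (frac-small; frac-near-one)

Eventually : (ℕ → Set) → Set
Eventually P = Σ ℕ λ N → ∀ m → N ≤ m → P m

mainTheorem2 : (ns ks : ℕ → ℕ)
    → (∀ m → 1 ≤ ks m) → (∀ m → ks m ≤ ns m)
    → (∀ M → Σ ℕ λ N → ∀ m → N ≤ m → M ≤ ns m)
    → ((∀ M → Σ ℕ λ N → ∀ m → N ≤ m → M * ks m ^ 3 ≤ ns m)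
        → ∀ j → Σ ℕ λ N → ∀ m → N ≤ m → ∣ frac (q (ns m) (ks m)) (p (ns m) (ks m)) - 1ℚ ∣ ≤ℚ invSuc j)
    × ((∀ j → Σ ℕ λ N → ∀ m → N ≤ m → ns m * suc j < ks m ^ 3)
        → ∀ j → Σ ℕ λ N → ∀ m → N ≤ m → ∣ frac (q (ns m) (ks m)) (p (ns m) (ks m)) ∣ ≤ℚ invSuc j)
mainTheorem2 ns ks 1≤k k≤n _ = part-i , part-ii
  where
  p-positive : ∀ m → 1 ≤ p (ns m) (ks m)
  p-positive m = p-pos (ns m) (ks m) (1≤k m) (k≤n m)

  ratio : ℕ → ℚ
  ratio m = frac (q (ns m) (ks m)) (p (ns m) (ks m))

  part-i : (∀ M → Eventually (λ m → M * ks m ^ 3 ≤ ns m)) → ∀ j → Eventually (λ m → ∣ ratio m - 1ℚ ∣ ≤ℚ invSuc j)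
  part-i n≫k³ j = proj₁ (n≫k³ M) , λ m N≤m →
    frac-near-one (q (ns m) (ks m)) (p (ns m) (ks m)) j (p-positive m) (q≤p (ns m) (ks m))
      (part-i-pointwise j (ns m) (ks m) (1≤k m) (k≤n m) (proj₂ (n≫k³ M) m N≤m))
    where
    M : ℕ
    M = 2 * suc j + 1

  part-ii : (∀ j → Eventually (λ m → ns m * suc j < ks m ^ 3)) → ∀ j → Eventually (λ m → ∣ ratio m ∣ ≤ℚ invSuc j)
  part-ii n≪k³ j = proj₁ (n≪k³ c) , λ m N≤m →
    frac-small (q (ns m) (ks m)) (p (ns m) (ks m)) j (p-positive m)
      (part-ii-bound j (ns m) (ks m) (k≤n m) (≤-<-trans (*-monoʳ-≤ (ns m) (n≤1+n c)) (proj₂ (n≪k³ c) m N≤m)))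
    where
    c : ℕ
    c = 512 * (suc j * suc j)
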